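{- Let $E \subseteq (\mathbb{Z}/2\mathbb{Z})^4$. Then $E$ is a tiling set if and only if $E$ is a spectral set.
   Context: For a prime $p$ and $d \ge 1$, a set $E \subseteq (\mathbb{Z}/p\mathbb{Z})^d$ is called tiling if there exists $T \subseteq (\mathbb{Z}/p\mathbb{Z})^d$ such that the translates $\{E + t : t \in T\}$ partition $(\mathbb{Z}/p\mathbb{Z})^d$. For $\mathbf{a} \in (\mathbb{Z}/p\mathbb{Z})^d$, the character $\chi_{\mathbf{a}}$ is the function $\chi_{\mathbf{a}}(\mathbf{x}) = e^{\frac{2\pi i}{p}(a_1x_1+\dots+a_dx_d)}$. Let $L^2(E)$ denote the space of functions $E \to \mathbb{C}$ with inner product $\langle f,g\rangle = \frac{1}{|E|}\sum_{x\in E} f(x)\overline{g(x)}$. The set $E$ is called spectral if there exists $A \subseteq (\mathbb{Z}/p\mathbb{Z})^d$ such that $\{\chi_{\mathbf{a}}|_E : \mathbf{a} \in A\}$ is an orthogonal basis of $L^2(E)$. Here $p=2$, $d=4$. -}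

module Defs where

open import Data.Bool using (Bool; true; false; _xor_; _∧_; if_then_else_)
open import Data.Vec using (Vec; []; _∷_; zipWith; foldr)
open import Data.List as List using (List; []; _∷_; _++_; map; filter)
open import Data.Nat using (ℕ; zero; suc)
open import Data.Product using (Σ; _×_; _,_)
open import Data.Rational using (ℚ; 0ℚ; 1ℚ; -_; _+_; _*_)
open import Relation.Binary.PropositionalEquality using (_≡_; _≢_)
open import Relation.Nullary using (¬_)
open import Data.Bool.Properties using (T?)
open import Data.Bool using (T)

-- (ℤ/2ℤ)^d, with ℤ/2ℤ represented by Bool (false = 0, true = 1)
Pt : ℕ → Set
Pt d = Vec Bool d

_⊕_ : ∀ {d} → Pt d → Pt d → Pt d
_⊕_ = zipWith _xor_

dot : ∀ {d} → Pt d → Pt d → Bool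
dot a x = foldr _ _xor_ false (zipWith _∧_ a x)

allPts : (d : ℕ) → List (Pt d)
allPts zero = [] ∷ []
allPts (suc d) = map (false ∷_) (allPts d) ++ map (true ∷_) (allPts d)

Subset : ℕ → Set
Subset d = Pt d → Bool

_∈_ : ∀ {d} → Pt d → Subset d → Set
x ∈ E = E x ≡ true

sumOver : ∀ {d} → Subset d → (Pt d → ℚ) → ℚ
sumOver {d} S f = List.foldr (λ x acc → (if S x then f x else 0ℚ) + acc) 0ℚ (allPts d)

sign : Bool → ℚ
sign false = 1ℚ
sign true  = - 1ℚ

-- character χ_a(x) = e^{2πi(a·x)/2} = (-1)^{a·x}
χ : ∀ {d} → Pt d → Pt d → ℚ
χ a x = sign (dot a x)

-- (unnormalised) inner product on L²(E) for real-valued functions: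
-- |E| · ⟨f,g⟩ = Σ_{x∈E} f(x) g(x)   (conjugation is trivial on ±1 values)
ip : ∀ {d} → Subset d → (Pt d → ℚ) → (Pt d → ℚ) → ℚ
ip E f g = sumOver E (λ x → f x * g x)

-- E tiles: ∃ T such that the translates E + t (t ∈ T) partition (ℤ/2ℤ)^d,
-- i.e. every y lies in E + t for exactly one t ∈ T  (y ∈ E + t ⇔ y - t = y ⊕ t ∈ E)
Tiling : ∀ {d} → Subset d → Set
Tiling {d} E = Σ (Subset d) λ T → (y : Pt d) →
  Σ (Pt d) λ t → (t ∈ T × (y ⊕ t) ∈ E) ×
    ((t' : Pt d) → t' ∈ T → (y ⊕ t') ∈ E → t' ≡ t)

-- E spectral: ∃ A such that {χ_a|_E : a ∈ A} is an orthogonal basis of L²(E):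
-- pairwise orthogonal for distinct a, b ∈ A, and spanning L²(E)
-- (linear combinations with coefficients c_a, a ∈ A).
Spectral : ∀ {d} → Subset d → Set
Spectral {d} E = Σ (Subset d) λ A →
  ((a b : Pt d) → a ∈ A → b ∈ A → a ≢ b → ip E (χ a) (χ b) ≡ 0ℚ) ×
  ((f : Pt d → ℚ) → Σ (Pt d → ℚ) λ c →
     (x : Pt d) → x ∈ E → f x ≡ sumOver A (λ a → c a * χ a x))

Nonempty : ∀ {d} → Subset d → Set
Nonempty {d} E = Σ (Pt d) λ x → x ∈ E

{-# OPTIONS --safe #-}
module Submission where

-- Write Ŝ(v) = Σ_{x ∈ S} (-1)^{v·x} and G = (ℤ/2ℤ)^4.  If A is a spectrum of E then |A| = |E|,
-- Ê vanishes on (A − A) ∖ {0} and, the character table being square, Â vanishes on (E − E) ∖ {0}.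
-- Three points a, b, c of A give Ê(a + b) = Ê(a + c) = Ê(b + c) = 0, which forces 4 ∣ |E|; if
-- |E| > 8 then A − A = G by pigeonhole, so Ê vanishes off 0 and |E| = 16; and if E − E = G then
-- Â vanishes off 0 and |A| = 16.  Hence a spectral E has |E| ∣ 16, and E − E ≠ G unless E = G.
-- A tile satisfies the same two conditions: |T| |E| = 16, and E − E = G forces |T| = 1.
-- Conversely every E meeting them tiles by a subgroup H (for |E| = 8 take H = {0, t} with
-- t ∉ E − E; for |E| ≤ 4 a subgroup is found by evaluation), and a set tiling by a subgroup H
-- is spectral with spectrum H^⊥: Ê(v) Ĥ(v) = Ĝ(v) = 0 for v ≠ 0 while Ĥ = |H| on H^⊥, and a
-- function on E extends H-periodically to G, where its Fourier transform vanishes off H^⊥.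

open import Defs

open import Algebra.Bundles using (CommutativeRing; CommutativeSemigroup)
open import Algebra.Core using (Op₂)
import Algebra.Properties.CommutativeSemigroup
import Algebra.Properties.Group
open import Algebra.Structures using (IsCommutativeSemiring; IsCommutativeRing)
open import Data.Bool using (Bool; true; false; _xor_; _∧_; _∨_; not; if_then_else_)
open import Data.Bool.ListAction using (all; any)
open import Data.Bool.Properties
  using ( xor-assoc; xor-comm; xor-same; xor-identityˡ; xor-identityʳ; xor-∧-commutativeRing
        ; ∧-comm; ∧-distribʳ-xor; ∧-zeroʳ; ∧-identityʳ; ∧-conicalˡ; ∧-conicalʳ; ∨-conicalˡ; ∨-conicalʳ
        ; not-injective; not-involutive; if-swap-then; if-float; T-≡ )
  renaming (_≟_ to _≟ᵇ_)
open import Data.Empty using (⊥-elim)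
open import Data.List as List using (List; []; _∷_; _++_)
open import Data.List.Membership.Propositional using () renaming (_∈_ to _∈ₗ_)
open import Data.List.Membership.Propositional.Properties
  using (∈-++⁺ˡ; ∈-++⁺ʳ; ∈-++⁻; ∈-map⁺; ∈-map⁻; ∈-filter⁺; ∈-filter⁻)
open import Data.List.Properties using (foldr-++; foldr-map; filter-accept)
open import Data.List.Relation.Unary.All as All using ()
open import Data.List.Relation.Unary.All.Properties using (all⁺)
open import Data.List.Relation.Unary.Any as Any using (here; there)
open import Data.List.Relation.Unary.Any.Properties using (any⁻)
open import Data.Nat as ℕ using (ℕ; zero; suc; _^_)
open import Data.Nat.Divisibility using (_∣_; divides; _∣?_; ∣⇒≤)
import Data.Nat.Properties as ℕₚ
open import Data.Product using (Σ; ∃; _×_; _,_; proj₁; proj₂)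
open import Data.Rational as ℚ using (ℚ; 0ℚ; 1ℚ)
import Data.Rational.Properties as ℚₚ
open import Algebra.Properties.Semiring.Mult (CommutativeRing.semiring ℚₚ.+-*-commutativeRing)
  using (×-homo-+) renaming (_×_ to _×ℚ_)
open import Data.Sum using (_⊎_; inj₁; inj₂; fromInj₂)
open import Data.Vec using ([]; _∷_; replicate)
open import Data.Vec.Properties using (≡-dec; zipWith-assoc; zipWith-comm; zipWith-identityˡ; zipWith-identityʳ)
open import Function using (_∘_)
open import Function.Bundles using (Equivalence)
open import Level using (0ℓ)
open import Relation.Binary.Definitions using (DecidableEquality)
open import Relation.Binary.PropositionalEquality
open import Relation.Nullary using (¬_; does; yes; no; contradiction)
open import Relation.Nullary.Decidable using (dec-true; dec-false; from-yes; _→-dec_; _⊎-dec_)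
open import Relation.Unary using (Decidable)
open ≡-Reasoning

variable
  d e : ℕ

-- The group (ℤ/2ℤ)^d and its characters

ε : Pt d
ε {d} = replicate d false

_≟_ : DecidableEquality (Pt d)
_≟_ = ≡-dec _≟ᵇ_

⊕-assoc : (x y z : Pt d) → (x ⊕ y) ⊕ z ≡ x ⊕ (y ⊕ z)
⊕-assoc = zipWith-assoc xor-assoc

⊕-comm : (x y : Pt d) → x ⊕ y ≡ y ⊕ x
⊕-comm = zipWith-comm xor-comm

⊕-identityˡ : (x : Pt d) → ε ⊕ x ≡ x
⊕-identityˡ = zipWith-identityˡ xor-identityˡ

⊕-identityʳ : (x : Pt d) → x ⊕ ε ≡ x
⊕-identityʳ = zipWith-identityʳ xor-identityʳ

⊕-self : (x : Pt d) → x ⊕ x ≡ ε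
⊕-self []      = refl
⊕-self (b ∷ x) = cong₂ _∷_ (xor-same b) (⊕-self x)

⊕-cancelʳ : (x y : Pt d) → (x ⊕ y) ⊕ y ≡ x
⊕-cancelʳ x y = begin
  (x ⊕ y) ⊕ y ≡⟨ ⊕-assoc x y y ⟩
  x ⊕ (y ⊕ y) ≡⟨ cong (x ⊕_) (⊕-self y) ⟩
  x ⊕ ε       ≡⟨ ⊕-identityʳ x ⟩
  x           ∎

⊕-cancelˡ : (x y : Pt d) → x ⊕ (x ⊕ y) ≡ y
⊕-cancelˡ x y = begin
  x ⊕ (x ⊕ y) ≡⟨ ⊕-comm x (x ⊕ y) ⟩
  (x ⊕ y) ⊕ x ≡⟨ cong (_⊕ x) (⊕-comm x y) ⟩
  (y ⊕ x) ⊕ x ≡⟨ ⊕-cancelʳ y x ⟩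
  y           ∎

⊕≡ε⇒≡ : (x y : Pt d) → x ⊕ y ≡ ε → x ≡ y
⊕≡ε⇒≡ x y x⊕y≡ε = begin
  x           ≡⟨ ⊕-cancelʳ x y ⟨
  (x ⊕ y) ⊕ y ≡⟨ cong (_⊕ y) x⊕y≡ε ⟩
  ε ⊕ y       ≡⟨ ⊕-identityˡ y ⟩
  y           ∎

⊕-left-comm : (a b c : Pt d) → a ⊕ (b ⊕ c) ≡ b ⊕ (a ⊕ c)
⊕-left-comm a b c = begin
  a ⊕ (b ⊕ c)  ≡⟨ ⊕-assoc a b c ⟨
  (a ⊕ b) ⊕ c  ≡⟨ cong (_⊕ c) (⊕-comm a b) ⟩
  (b ⊕ a) ⊕ c  ≡⟨ ⊕-assoc b a c ⟩
  b ⊕ (a ⊕ c)  ∎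

⊕-difference : (a b c : Pt d) → (a ⊕ b) ⊕ (a ⊕ c) ≡ b ⊕ c
⊕-difference a b c = begin
  (a ⊕ b) ⊕ (a ⊕ c)   ≡⟨ ⊕-assoc a b (a ⊕ c) ⟩
  a ⊕ (b ⊕ (a ⊕ c))   ≡⟨ cong (a ⊕_) (⊕-left-comm b a c) ⟩
  a ⊕ (a ⊕ (b ⊕ c))   ≡⟨ ⊕-cancelˡ a (b ⊕ c) ⟩
  b ⊕ c               ∎

≢-translate : {x v : Pt d} → v ≢ ε → x ≢ x ⊕ v
≢-translate {x = x} {v} v≢ε x≡x⊕v = v≢ε (begin
  v            ≡⟨ ⊕-cancelˡ x v ⟨
  x ⊕ (x ⊕ v)  ≡⟨ cong (x ⊕_) x≡x⊕v ⟨
  x ⊕ x        ≡⟨ ⊕-self x ⟩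
  ε            ∎)

dot-ε : (x : Pt d) → dot ε x ≡ false
dot-ε []      = refl
dot-ε (_ ∷ x) = dot-ε x

dot-comm : (a x : Pt d) → dot a x ≡ dot x a
dot-comm []      []      = refl
dot-comm (a ∷ as) (x ∷ xs) = cong₂ _xor_ (∧-comm a x) (dot-comm as xs)

dot-⊕ˡ : (a b x : Pt d) → dot (a ⊕ b) x ≡ dot a x xor dot b x
dot-⊕ˡ []       []       []       = refl
dot-⊕ˡ (a ∷ as) (b ∷ bs) (x ∷ xs) = begin
  ((a xor b) ∧ x) xor dot (as ⊕ bs) xs
    ≡⟨ cong₂ _xor_ (∧-distribʳ-xor x a b) (dot-⊕ˡ as bs xs) ⟩
  ((a ∧ x) xor (b ∧ x)) xor (dot as xs xor dot bs xs)
    ≡⟨ xor-interchange (a ∧ x) (b ∧ x) (dot as xs) (dot bs xs) ⟩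
  ((a ∧ x) xor dot as xs) xor ((b ∧ x) xor dot bs xs) ∎
  where open Algebra.Properties.CommutativeSemigroup (CommutativeRing.+-commutativeSemigroup xor-∧-commutativeRing)
          renaming (interchange to xor-interchange)

dot-⊕ʳ : (a x y : Pt d) → dot a (x ⊕ y) ≡ dot a x xor dot a y
dot-⊕ʳ a x y = begin
  dot a (x ⊕ y)           ≡⟨ dot-comm a (x ⊕ y) ⟩
  dot (x ⊕ y) a           ≡⟨ dot-⊕ˡ x y a ⟩
  dot x a xor dot y a     ≡⟨ cong₂ _xor_ (dot-comm x a) (dot-comm y a) ⟩
  dot a x xor dot a y     ∎

sign-xor : (b c : Bool) → sign (b xor c) ≡ sign b ℚ.* sign c
sign-xor false c     = sym (ℚₚ.*-identityˡ (sign c))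
sign-xor true  false = refl
sign-xor true  true  = refl

χ-ε : (x : Pt d) → χ ε x ≡ 1ℚ
χ-ε x = cong sign (dot-ε x)

χ-comm : (a x : Pt d) → χ a x ≡ χ x a
χ-comm a x = cong sign (dot-comm a x)

χ-⊕ˡ : (a b x : Pt d) → χ (a ⊕ b) x ≡ χ a x ℚ.* χ b x
χ-⊕ˡ a b x = trans (cong sign (dot-⊕ˡ a b x)) (sign-xor (dot a x) (dot b x))

χ-⊕ʳ : (a x y : Pt d) → χ a (x ⊕ y) ≡ χ a x ℚ.* χ a y
χ-⊕ʳ a x y = trans (cong sign (dot-⊕ʳ a x y)) (sign-xor (dot a x) (dot a y))

χ-square : (a x : Pt d) → χ a x ℚ.* χ a x ≡ 1ℚ
χ-square a x with dot a x
... | false = refl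
... | true  = refl

anyPt : (Pt d → Bool) → Bool
anyPt {zero}  P = P []
anyPt {suc d} P = anyPt (P ∘ (false ∷_)) ∨ anyPt (P ∘ (true ∷_))

anyPt-true : (P : Pt d → Bool) → anyPt P ≡ true → ∃ λ x → P x ≡ true
anyPt-true {zero}  P found = [] , found
anyPt-true {suc d} P found with anyPt (P ∘ (false ∷_)) in eq
... | true  = let x , Px = anyPt-true (P ∘ (false ∷_)) eq    in false ∷ x , Px
... | false = let x , Px = anyPt-true (P ∘ (true ∷_)) found in true ∷ x , Px

anyPt-false : (P : Pt d → Bool) → anyPt P ≡ false → ∀ x → P x ≡ false
anyPt-false {zero}  P none [] = none
anyPt-false {suc d} P none (false ∷ x) = anyPt-false (P ∘ (false ∷_)) (∨-conicalˡ _ _ none) x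
anyPt-false {suc d} P none (true ∷ x)  = anyPt-false (P ∘ (true ∷_)) (∨-conicalʳ _ _ none) x

allPt : (Pt d → Bool) → Bool
allPt P = not (anyPt (not ∘ P))

allPt-true : (P : Pt d → Bool) → allPt P ≡ true → ∀ x → P x ≡ true
allPt-true P everywhere x = not-injective (anyPt-false (not ∘ P) (not-injective everywhere) x)

allPt-false : (P : Pt d → Bool) → allPt P ≡ false → ∃ λ x → P x ≡ false
allPt-false P some = let x , ¬Px = anyPt-true (not ∘ P) (not-injective some) in x , not-injective ¬Px

infixl 25 _∖_

_∖_ : Subset d → Pt d → Subset d
(S ∖ a) x = S x ∧ not (does (x ≟ a))

∈-∖ : {S : Subset d} {a x : Pt d} → x ∈ S ∖ a → x ∈ S × x ≢ a
∈-∖ {S = S} {a} {x} x∈S∖a with x ≟ a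
... | yes _   = contradiction (trans (sym (∧-zeroʳ (S x))) x∈S∖a) λ ()
... | no x≢a = trans (sym (∧-identityʳ (S x))) x∈S∖a , x≢a

Tiles : Subset d → Subset d → Set
Tiles {d} E T = (y : Pt d) →
  Σ (Pt d) λ t → (t ∈ T × (y ⊕ t) ∈ E) × ((t' : Pt d) → t' ∈ T → (y ⊕ t') ∈ E → t' ≡ t)

DifferencesCover : Subset d → Set
DifferencesCover {d} E = (v : Pt d) → ∃ λ x → x ∈ E × (x ⊕ v) ∈ E

differences-cover? : (E : Subset d) → DifferencesCover E ⊎ ∃ λ t → ∀ x → (E x ∧ E (x ⊕ t)) ≡ false
differences-cover? E with allPt (λ v → anyPt (λ x → E x ∧ E (x ⊕ v))) in cover
... | true  = inj₁ λ v →
  let x , both = anyPt-true _ (allPt-true _ cover v) in x , ∧-conicalˡ _ _ both , ∧-conicalʳ _ _ both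
... | false = let t , no-x = allPt-false _ cover in inj₂ (t , anyPt-false _ no-x)

IsSubgroup : Subset d → Set
IsSubgroup H = ε ∈ H × (∀ {x y} → x ∈ H → y ∈ H → (x ⊕ y) ∈ H)

TilesBySubgroup : Subset d → Set
TilesBySubgroup {d} E = Σ (Subset d) λ H → IsSubgroup H × Tiles E H

infix 30 _⊥

_⊥ : Subset d → Subset d
(H ⊥) a = allPt λ h → not (H h ∧ dot a h)

⊥-orthogonal : {H : Subset d} {a h : Pt d} → a ∈ H ⊥ → h ∈ H → dot a h ≡ false
⊥-orthogonal {H = H} {a} {h} a∈H⊥ h∈H =
  not-injective (trans (cong (λ b → not (b ∧ dot a h)) (sym h∈H)) (allPt-true _ a∈H⊥ h))

⊥-witness : {H : Subset d} {a : Pt d} → (H ⊥) a ≡ false → ∃ λ h → h ∈ H × dot a h ≡ true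
⊥-witness {H = H} {a} a∉H⊥ =
  let h , found = anyPt-true _ (not-injective a∉H⊥)
      both = trans (sym (not-involutive (H h ∧ dot a h))) found
  in h , ∧-conicalˡ _ _ both , ∧-conicalʳ _ _ both

⊥-closed : {H : Subset d} {a b : Pt d} → a ∈ H ⊥ → b ∈ H ⊥ → (a ⊕ b) ∈ H ⊥
⊥-closed {H = H} {a} {b} a∈H⊥ b∈H⊥ with (H ⊥) (a ⊕ b) in a⊕b∈H⊥
... | true  = refl
... | false = let h , h∈H , a⊕b·h≡1 = ⊥-witness {H = H} {a ⊕ b} a⊕b∈H⊥ in
  contradiction (begin
    false                        ≡⟨⟩
    false xor false              ≡⟨ cong₂ _xor_ (⊥-orthogonal {H = H} {a} a∈H⊥ h∈H)
                                                (⊥-orthogonal {H = H} {b} b∈H⊥ h∈H) ⟨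
    dot a h xor dot b h          ≡⟨ dot-⊕ˡ a b h ⟨
    dot (a ⊕ b) h                ≡⟨ a⊕b·h≡1 ⟩
    true                         ∎) λ ()

-- Sums over (ℤ/2ℤ)^d

module Sums {R : Set} {_+_ _*_ : Op₂ R} {0# 1# : R}
            (isCommutativeSemiring : IsCommutativeSemiring _≡_ _+_ _*_ 0# 1#) where

  open IsCommutativeSemiring isCommutativeSemiring
    using (+-assoc; +-comm; +-identityˡ; +-identityʳ; *-comm; distribˡ; zeroʳ; +-isCommutativeSemigroup)

  ∑ : (Pt d → R) → R
  ∑ {zero}  f = f []
  ∑ {suc d} f = ∑ (f ∘ (false ∷_)) + ∑ (f ∘ (true ∷_))

  ∑∈ : Subset d → (Pt d → R) → R
  ∑∈ S f = ∑ λ x → if S x then f x else 0#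

  ∑-cong : {f g : Pt d → R} → (∀ x → f x ≡ g x) → ∑ f ≡ ∑ g
  ∑-cong {zero}  f≗g = f≗g []
  ∑-cong {suc d} f≗g = cong₂ _+_ (∑-cong (f≗g ∘ (false ∷_))) (∑-cong (f≗g ∘ (true ∷_)))

  ∑-0 : ∑ {d} (λ _ → 0#) ≡ 0#
  ∑-0 {zero}  = refl
  ∑-0 {suc d} = trans (cong₂ _+_ (∑-0 {d}) (∑-0 {d})) (+-identityˡ 0#)

  +-commutativeSemigroup : CommutativeSemigroup 0ℓ 0ℓ
  +-commutativeSemigroup = record { isCommutativeSemigroup = +-isCommutativeSemigroup }

  ∑-+ : (f g : Pt d → R) → ∑ (λ x → f x + g x) ≡ ∑ f + ∑ g
  ∑-+ {zero}  f g = refl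
  ∑-+ {suc d} f g = trans (cong₂ _+_ (∑-+ (f ∘ (false ∷_)) (g ∘ (false ∷_)))
                                     (∑-+ (f ∘ (true ∷_)) (g ∘ (true ∷_))))
                          (interchange _ _ _ _)
    where open Algebra.Properties.CommutativeSemigroup +-commutativeSemigroup using (interchange)

  ∑-*ˡ : (c : R) (f : Pt d → R) → ∑ (λ x → c * f x) ≡ c * ∑ f
  ∑-*ˡ {zero}  c f = refl
  ∑-*ˡ {suc d} c f = trans (cong₂ _+_ (∑-*ˡ c (f ∘ (false ∷_))) (∑-*ˡ c (f ∘ (true ∷_))))
                           (sym (distribˡ c _ _))

  ∑-*ʳ : (c : R) (f : Pt d → R) → ∑ (λ x → f x * c) ≡ ∑ f * c
  ∑-*ʳ c f = trans (∑-cong λ x → *-comm (f x) c) (trans (∑-*ˡ c f) (*-comm c (∑ f)))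

  ∑-comm : (f : Pt d → Pt e → R) → ∑ (λ x → ∑ (f x)) ≡ ∑ (λ y → ∑ (λ x → f x y))
  ∑-comm {zero}  f = refl
  ∑-comm {suc d} f = begin
    ∑ (λ x → ∑ (f (false ∷ x))) + ∑ (λ x → ∑ (f (true ∷ x)))
      ≡⟨ cong₂ _+_ (∑-comm (f ∘ (false ∷_))) (∑-comm (f ∘ (true ∷_))) ⟩
    ∑ (λ y → ∑ (λ x → f (false ∷ x) y)) + ∑ (λ y → ∑ (λ x → f (true ∷ x) y))
      ≡⟨ ∑-+ (λ y → ∑ (λ x → f (false ∷ x) y)) (λ y → ∑ (λ x → f (true ∷ x) y)) ⟨
    ∑ (λ y → ∑ (λ x → f (false ∷ x) y) + ∑ (λ x → f (true ∷ x) y))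
      ∎

  ∑-shift : (t : Pt d) (f : Pt d → R) → ∑ (λ x → f (x ⊕ t)) ≡ ∑ f
  ∑-shift {zero}  []          f = refl
  ∑-shift {suc d} (false ∷ t) f =
    cong₂ _+_ (∑-shift t (f ∘ (false ∷_))) (∑-shift t (f ∘ (true ∷_)))
  ∑-shift {suc d} (true ∷ t)  f =
    trans (cong₂ _+_ (∑-shift t (f ∘ (true ∷_))) (∑-shift t (f ∘ (false ∷_)))) (+-comm _ _)

  ∑-δ : (a : Pt d) (f : Pt d → R) → ∑ (λ x → if does (x ≟ a) then f x else 0#) ≡ f a
  ∑-δ {zero}  []          f = refl
  ∑-δ {suc d} (false ∷ a) f =
    trans (cong₂ _+_ (∑-δ a (f ∘ (false ∷_))) (∑-0 {d})) (+-identityʳ _)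
  ∑-δ {suc d} (true ∷ a)  f =
    trans (cong₂ _+_ (∑-0 {d}) (∑-δ a (f ∘ (true ∷_)))) (+-identityˡ _)

  if-∑ : (b : Bool) (f : Pt d → R) → (if b then ∑ f else 0#) ≡ ∑ (λ x → if b then f x else 0#)
  if-∑ true  f = refl
  if-∑ {d} false f = sym (∑-0 {d})

  ∑∈-cong : (S : Subset d) {f g : Pt d → R} → (∀ x → x ∈ S → f x ≡ g x) → ∑∈ S f ≡ ∑∈ S g
  ∑∈-cong S {f} {g} f≗g = ∑-cong pointwise
    where
    pointwise : ∀ x → (if S x then f x else 0#) ≡ (if S x then g x else 0#)
    pointwise x with S x in x∈S
    ... | true  = f≗g x x∈S
    ... | false = refl

  ∑∈-*ˡ : (S : Subset d) (c : R) (f : Pt d → R) → ∑∈ S (λ x → c * f x) ≡ c * ∑∈ S f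
  ∑∈-*ˡ S c f = trans (∑-cong pointwise) (∑-*ˡ c (λ x → if S x then f x else 0#))
    where
    pointwise : ∀ x → (if S x then c * f x else 0#) ≡ c * (if S x then f x else 0#)
    pointwise x with S x
    ... | true  = refl
    ... | false = sym (zeroʳ c)

  ∑∈-*ʳ : (S : Subset d) (c : R) (f : Pt d → R) → ∑∈ S (λ x → f x * c) ≡ ∑∈ S f * c
  ∑∈-*ʳ S c f = trans (∑∈-cong S λ x _ → *-comm (f x) c) (trans (∑∈-*ˡ S c f) (*-comm c (∑∈ S f)))

  ∑-∑∈-comm : (S : Subset d) (f : Pt d → Pt d → R) →
              ∑ (λ x → ∑∈ S (f x)) ≡ ∑∈ S (λ y → ∑ (λ x → f x y))
  ∑-∑∈-comm S f = trans (∑-comm (λ x y → if S y then f x y else 0#))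
                        (∑-cong λ y → sym (if-∑ (S y) (λ x → f x y)))

  ∑∈-comm : (S S′ : Subset d) (f : Pt d → Pt d → R) →
            ∑∈ S (λ x → ∑∈ S′ (f x)) ≡ ∑∈ S′ (λ y → ∑∈ S (λ x → f x y))
  ∑∈-comm S S′ f = trans (∑-cong pointwise) (∑-∑∈-comm S′ (λ x y → if S x then f x y else 0#))
    where
    pointwise : ∀ x → (if S x then ∑∈ S′ (f x) else 0#) ≡ ∑∈ S′ (λ y → if S x then f x y else 0#)
    pointwise x = trans (if-∑ (S x) (λ y → if S′ y then f x y else 0#))
                        (∑-cong λ y → if-swap-then (S x) (S′ y))

  ∑∈-δ : (S : Subset d) (a : Pt d) (f : Pt d → R) →
         ∑∈ S (λ x → if does (x ≟ a) then f x else 0#) ≡ (if S a then f a else 0#)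
  ∑∈-δ S a f = trans (∑-cong λ x → if-swap-then (S x) (does (x ≟ a))) (∑-δ a (λ x → if S x then f x else 0#))

  ∑∈-+ : (S : Subset d) (f g : Pt d → R) → ∑∈ S (λ x → f x + g x) ≡ ∑∈ S f + ∑∈ S g
  ∑∈-+ S f g = trans (∑-cong pointwise) (∑-+ (λ x → if S x then f x else 0#) (λ x → if S x then g x else 0#))
    where
    pointwise : ∀ x → (if S x then f x + g x else 0#) ≡ (if S x then f x else 0#) + (if S x then g x else 0#)
    pointwise x with S x
    ... | true  = refl
    ... | false = sym (+-identityˡ 0#)

  ∑∈-full : {S : Subset d} {f : Pt d → R} → (∀ x → S x ≡ false → f x ≡ 0#) → ∑∈ S f ≡ ∑ f
  ∑∈-full {S = S} {f} vanishes = ∑-cong pointwise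
    where
    pointwise : ∀ x → (if S x then f x else 0#) ≡ f x
    pointwise x with S x in x∉S
    ... | true  = refl
    ... | false = sym (vanishes x x∉S)

  ∑-tiling : {E T : Subset d} → Tiles E T → (f : Pt d → R) →
             ∑ f ≡ ∑∈ T (λ t → ∑∈ E (λ y → f (y ⊕ t)))
  ∑-tiling {E = E} {T} tiles f = begin
    ∑ f
      ≡⟨ ∑-cong one-translate ⟨
    ∑ (λ g → ∑∈ T (λ t → if E (g ⊕ t) then f g else 0#))
      ≡⟨ ∑-∑∈-comm T (λ g t → if E (g ⊕ t) then f g else 0#) ⟩
    ∑∈ T (λ t → ∑ (λ g → if E (g ⊕ t) then f g else 0#))
      ≡⟨ ∑∈-cong T (λ t _ → sym (∑-shift t (λ g → if E (g ⊕ t) then f g else 0#))) ⟩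
    ∑∈ T (λ t → ∑ (λ y → if E ((y ⊕ t) ⊕ t) then f (y ⊕ t) else 0#))
      ≡⟨ ∑∈-cong T (λ t _ → ∑-cong λ y → cong (if_then f (y ⊕ t) else 0#) (cong E (⊕-cancelʳ y t))) ⟩
    ∑∈ T (λ t → ∑∈ E (λ y → f (y ⊕ t)))
      ∎
    where
    one-translate : ∀ g → ∑∈ T (λ t → if E (g ⊕ t) then f g else 0#) ≡ f g
    one-translate g = trans (∑-cong pointwise) (∑-δ t₀ (λ _ → f g))
      where
      t₀ = proj₁ (tiles g)
      pointwise : ∀ t → (if T t then (if E (g ⊕ t) then f g else 0#) else 0#)
                        ≡ (if does (t ≟ t₀) then f g else 0#)
      pointwise t with t ≟ t₀
      ... | yes refl rewrite proj₁ (proj₁ (proj₂ (tiles g))) | proj₂ (proj₁ (proj₂ (tiles g))) = refl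
      ... | no t≢t₀ with T t in t∈T | E (g ⊕ t) in g⊕t∈E
      ...   | true  | true  = ⊥-elim (t≢t₀ (proj₂ (proj₂ (tiles g)) t t∈T g⊕t∈E))
      ...   | true  | false = refl
      ...   | false | _     = refl

  foldr-allPts : (f : Pt d → R) → List.foldr (λ x acc → f x + acc) 0# (allPts d) ≡ ∑ f
  foldr-allPts {zero}  f = +-identityʳ (f [])
  foldr-allPts {suc d} f = begin
    List.foldr step 0# (List.map (false ∷_) (allPts d) ++ List.map (true ∷_) (allPts d))
      ≡⟨ foldr-++ step 0# (List.map (false ∷_) (allPts d)) _ ⟩
    List.foldr step (List.foldr step 0# (List.map (true ∷_) (allPts d))) (List.map (false ∷_) (allPts d))
      ≡⟨ foldr-acc (List.map (false ∷_) (allPts d)) _ ⟩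
    List.foldr step 0# (List.map (false ∷_) (allPts d)) + List.foldr step 0# (List.map (true ∷_) (allPts d))
      ≡⟨ cong₂ _+_ (trans (foldr-map step (false ∷_) 0# (allPts d)) (foldr-allPts (f ∘ (false ∷_))))
                   (trans (foldr-map step (true ∷_) 0# (allPts d)) (foldr-allPts (f ∘ (true ∷_)))) ⟩
    ∑ f ∎
    where
    step = λ x acc → f x + acc
    foldr-acc : (xs : List (Pt (suc d))) (a : R) → List.foldr step a xs ≡ List.foldr step 0# xs + a
    foldr-acc []       a = sym (+-identityˡ a)
    foldr-acc (x ∷ xs) a = trans (cong (f x +_) (foldr-acc xs a)) (sym (+-assoc _ _ _))

module ℕ∑ = Sums ℕₚ.+-*-isCommutativeSemiring

open Sums (IsCommutativeRing.isCommutativeSemiring ℚₚ.+-*-isCommutativeRing)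

size : Subset d → ℕ
size S = ℕ∑.∑∈ S (λ _ → 1)

∑-mono : {f g : Pt d → ℕ} → (∀ x → f x ℕ.≤ g x) → ℕ∑.∑ f ℕ.≤ ℕ∑.∑ g
∑-mono {zero}  f≤g = f≤g []
∑-mono {suc d} f≤g = ℕₚ.+-mono-≤ (∑-mono (f≤g ∘ (false ∷_))) (∑-mono (f≤g ∘ (true ∷_)))

∑-1 : ℕ∑.∑ {d} (λ _ → 1) ≡ 2 ^ d
∑-1 {zero}  = refl
∑-1 {suc d} = trans (cong₂ ℕ._+_ (∑-1 {d}) (∑-1 {d})) (cong (2 ^ d ℕ.+_) (sym (ℕₚ.+-identityʳ (2 ^ d))))

size-shift : (S : Subset d) (v : Pt d) → size (λ x → S (x ⊕ v)) ≡ size S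
size-shift S v = ℕ∑.∑-shift v (λ x → if S x then 1 else 0)

size-∨ : (S S′ : Subset d) → (∀ x → (S x ∧ S′ x) ≡ false) →
         size (λ x → S x ∨ S′ x) ≡ size S ℕ.+ size S′
size-∨ S S′ disjoint =
  trans (ℕ∑.∑-cong pointwise) (ℕ∑.∑-+ (λ x → if S x then 1 else 0) (λ x → if S′ x then 1 else 0))
  where
  pointwise : ∀ x → (if S x ∨ S′ x then 1 else 0) ≡ (if S x then 1 else 0) ℕ.+ (if S′ x then 1 else 0)
  pointwise x with S x | S′ x | disjoint x
  ... | true  | false | _ = refl
  ... | false | true  | _ = refl
  ... | false | false | _ = refl

size-≤ : (S : Subset d) → size S ℕ.≤ 2 ^ d
size-≤ {d} S = subst (size S ℕ.≤_) (∑-1 {d}) (∑-mono pointwise)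
  where
  pointwise : ∀ x → (if S x then 1 else 0) ℕ.≤ 1
  pointwise x with S x
  ... | true  = ℕₚ.≤-refl
  ... | false = ℕ.z≤n

size-< : (S : Subset d) (y : Pt d) → S y ≡ false → size S ℕ.< 2 ^ d
size-< {d} S y y∉S = subst₂ ℕ._≤_ counted (∑-1 {d}) (∑-mono pointwise)
  where
  counted : ℕ∑.∑ (λ x → (if S x then 1 else 0) ℕ.+ (if does (x ≟ y) then 1 else 0)) ≡ suc (size S)
  counted = begin
    ℕ∑.∑ (λ x → (if S x then 1 else 0) ℕ.+ (if does (x ≟ y) then 1 else 0))
      ≡⟨ ℕ∑.∑-+ (λ x → if S x then 1 else 0) (λ x → if does (x ≟ y) then 1 else 0) ⟩
    size S ℕ.+ ℕ∑.∑ (λ x → if does (x ≟ y) then 1 else 0)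
      ≡⟨ cong (size S ℕ.+_) (ℕ∑.∑-δ y (λ _ → 1)) ⟩
    size S ℕ.+ 1
      ≡⟨ ℕₚ.+-comm (size S) 1 ⟩
    suc (size S) ∎
  pointwise : ∀ x → (if S x then 1 else 0) ℕ.+ (if does (x ≟ y) then 1 else 0) ℕ.≤ 1
  pointwise x with x ≟ y
  ... | yes refl rewrite y∉S = ℕₚ.≤-refl
  ... | no _ with S x
  ...   | true  = ℕₚ.≤-refl
  ...   | false = ℕ.z≤n

size-all : (S : Subset d) → (∀ x → x ∈ S) → size S ≡ 2 ^ d
size-all {d} S all∈S = trans (ℕ∑.∑-cong λ x → cong (if_then 1 else 0) (all∈S x)) (∑-1 {d})

size-full : (S : Subset d) → size S ≡ 2 ^ d → ∀ y → y ∈ S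
size-full S size≡2^d y with S y in y∈S
... | true  = refl
... | false = ⊥-elim (ℕₚ.<⇒≢ (size-< S y y∈S) size≡2^d)

size-remove : (S : Subset d) (a : Pt d) → a ∈ S → size S ≡ suc (size (S ∖ a))
size-remove S a a∈S = begin
  size S
    ≡⟨ ℕ∑.∑-cong pointwise ⟩
  ℕ∑.∑ (λ x → (if does (x ≟ a) then 1 else 0) ℕ.+ (if (S ∖ a) x then 1 else 0))
    ≡⟨ ℕ∑.∑-+ (λ x → if does (x ≟ a) then 1 else 0) (λ x → if (S ∖ a) x then 1 else 0) ⟩
  ℕ∑.∑ (λ x → if does (x ≟ a) then 1 else 0) ℕ.+ size (S ∖ a)
    ≡⟨ cong (ℕ._+ size (S ∖ a)) (ℕ∑.∑-δ a (λ _ → 1)) ⟩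
  suc (size (S ∖ a)) ∎
  where
  pointwise : ∀ x → (if S x then 1 else 0) ≡ (if does (x ≟ a) then 1 else 0) ℕ.+ (if (S ∖ a) x then 1 else 0)
  pointwise x with x ≟ a
  ... | yes refl rewrite a∈S = refl
  ... | no _ with S x
  ...   | true  = refl
  ...   | false = refl

size-∖ : (S : Subset d) {a : Pt d} {k : ℕ} → a ∈ S → suc k ℕ.≤ size S → k ℕ.≤ size (S ∖ a)
size-∖ S {a} a∈S k<|S| = ℕ.s≤s⁻¹ (subst (_ ℕ.≤_) (size-remove S a a∈S) k<|S|)

size-positive : (S : Subset d) {x : Pt d} → x ∈ S → 0 ℕ.< size S
size-positive S {x} x∈S = subst (0 ℕ.<_) (sym (size-remove S x x∈S)) ℕ.z<s

size-nonempty : (S : Subset d) → 1 ℕ.≤ size S → ∃ λ x → x ∈ S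
size-nonempty {d} S 1≤size with anyPt S in found
... | true  = anyPt-true S found
... | false = ⊥-elim (ℕₚ.<⇒≢ 1≤size (sym size≡0))
  where
  size≡0 : size S ≡ 0
  size≡0 = trans (ℕ∑.∑-cong λ x → cong (if_then 1 else 0) (anyPt-false S found x)) (ℕ∑.∑-0 {d})

three-elements : (S : Subset d) → 3 ℕ.≤ size S →
  ∃ λ a → ∃ λ b → ∃ λ c → (a ∈ S × b ∈ S × c ∈ S) × (b ≢ a × c ≢ a × c ≢ b)
three-elements S 3≤|S| =
  let a , a∈S       = size-nonempty S (ℕₚ.≤-trans (ℕ.s≤s ℕ.z≤n) 3≤|S|)
      2≤|S∖a|       = size-∖ S a∈S 3≤|S|
      b , b∈S∖a     = size-nonempty (S ∖ a) (ℕₚ.≤-trans (ℕ.s≤s ℕ.z≤n) 2≤|S∖a|)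
      c , c∈S∖a∖b   = size-nonempty (S ∖ a ∖ b) (size-∖ (S ∖ a) b∈S∖a 2≤|S∖a|)
      b∈S , b≢a     = ∈-∖ {S = S} b∈S∖a
      c∈S∖a , c≢b   = ∈-∖ {S = S ∖ a} c∈S∖a∖b
      c∈S , c≢a     = ∈-∖ {S = S} c∈S∖a
  in a , b , c , (a∈S , b∈S , c∈S) , (b≢a , c≢a , c≢b)

tile-count : {E T : Subset d} → Tiles E T → size E ℕ.* size T ≡ 2 ^ d
tile-count {d} {E} {T} tiles = begin
  size E ℕ.* size T          ≡⟨ ℕ∑.∑∈-*ˡ T (size E) (λ _ → 1) ⟨
  ℕ∑.∑∈ T (λ _ → size E ℕ.* 1) ≡⟨ ℕ∑.∑∈-cong T (λ _ _ → ℕₚ.*-identityʳ (size E)) ⟩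
  ℕ∑.∑∈ T (λ _ → size E)     ≡⟨ ℕ∑.∑-tiling tiles (λ _ → 1) ⟨
  ℕ∑.∑ {d} (λ _ → 1)         ≡⟨ ∑-1 {d} ⟩
  2 ^ d                      ∎

tiling-size-∣ : {E : Subset d} → Tiling E → size E ∣ 2 ^ d
tiling-size-∣ {E = E} (T , tiles) =
  divides (size T) (trans (sym (tile-count tiles)) (ℕₚ.*-comm (size E) (size T)))

fromℕ : ℕ → ℚ
fromℕ n = n ×ℚ 1ℚ

fromℕ-+ : (m n : ℕ) → fromℕ (m ℕ.+ n) ≡ fromℕ m ℚ.+ fromℕ n
fromℕ-+ = ×-homo-+ 1ℚ

fromℕ≢0 : {n : ℕ} → 0 ℕ.< n → fromℕ n ≢ 0ℚ
fromℕ≢0 {suc n} _ = ≢-sym (ℚₚ.<⇒≢ (ℚₚ.+-mono-<-≤ (ℚₚ.positive⁻¹ 1ℚ) (fromℕ-nonNegative n)))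
  where
  fromℕ-nonNegative : (n : ℕ) → 0ℚ ℚ.≤ fromℕ n
  fromℕ-nonNegative zero    = ℚₚ.≤-refl
  fromℕ-nonNegative (suc n) = ℚₚ.+-mono-≤ (ℚₚ.nonNegative⁻¹ 1ℚ) (fromℕ-nonNegative n)

fromℕ-injective : {m n : ℕ} → fromℕ m ≡ fromℕ n → m ≡ n
fromℕ-injective {zero}  {zero}  _  = refl
fromℕ-injective {zero}  {suc n} eq = ⊥-elim (fromℕ≢0 {suc n} ℕ.z<s (sym eq))
fromℕ-injective {suc m} {zero}  eq = ⊥-elim (fromℕ≢0 {suc m} ℕ.z<s eq)
fromℕ-injective {suc m} {suc n} eq = cong suc (fromℕ-injective (+-cancelˡ 1ℚ (fromℕ m) (fromℕ n) eq))
  where open Algebra.Properties.Group ℚₚ.+-0-group renaming (∙-cancelˡ to +-cancelˡ)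

∑-fromℕ : (f : Pt d → ℕ) → ∑ (λ x → fromℕ (f x)) ≡ fromℕ (ℕ∑.∑ f)
∑-fromℕ {zero}  f = refl
∑-fromℕ {suc d} f = trans (cong₂ ℚ._+_ (∑-fromℕ (f ∘ (false ∷_))) (∑-fromℕ (f ∘ (true ∷_))))
                          (sym (fromℕ-+ (ℕ∑.∑ (f ∘ (false ∷_))) (ℕ∑.∑ (f ∘ (true ∷_)))))

∑∈-fromℕ : (S : Subset d) (f : Pt d → ℕ) → ∑∈ S (λ x → fromℕ (f x)) ≡ fromℕ (ℕ∑.∑∈ S f)
∑∈-fromℕ S f = trans (∑-cong λ x → sym (if-float fromℕ (S x))) (∑-fromℕ (λ x → if S x then f x else 0))

∑∈-1 : (S : Subset d) → ∑∈ S (λ _ → 1ℚ) ≡ fromℕ (size S)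
∑∈-1 S = ∑∈-fromℕ S (λ _ → 1)

p*q≡0⇒p≡0 : (p q : ℚ) → q ≢ 0ℚ → p ℚ.* q ≡ 0ℚ → p ≡ 0ℚ
p*q≡0⇒p≡0 p q q≢0 pq≡0 = begin
  p                       ≡⟨ ℚₚ.*-identityʳ p ⟨
  p ℚ.* 1ℚ                ≡⟨ cong (p ℚ.*_) (ℚₚ.*-inverseʳ q) ⟨
  p ℚ.* (q ℚ.* ℚ.1/ q)    ≡⟨ ℚₚ.*-assoc p q (ℚ.1/ q) ⟨
  (p ℚ.* q) ℚ.* ℚ.1/ q    ≡⟨ cong (ℚ._* ℚ.1/ q) pq≡0 ⟩
  0ℚ ℚ.* ℚ.1/ q           ≡⟨ ℚₚ.*-zeroˡ (ℚ.1/ q) ⟩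
  0ℚ                      ∎
  where instance _ = ℚ.≢-nonZero q≢0

p≡p*-1⇒p≡0 : (p : ℚ) → p ≡ p ℚ.* (ℚ.- 1ℚ) → p ≡ 0ℚ
p≡p*-1⇒p≡0 p p≡-p = p*q≡0⇒p≡0 p 2ℚ (λ ()) (begin
  p ℚ.* (1ℚ ℚ.+ 1ℚ)                    ≡⟨ ℚₚ.*-distribˡ-+ p 1ℚ 1ℚ ⟩
  p ℚ.* 1ℚ ℚ.+ p ℚ.* 1ℚ                ≡⟨ cong (ℚ._+ p ℚ.* 1ℚ) (trans (ℚₚ.*-identityʳ p) p≡-p) ⟩
  p ℚ.* (ℚ.- 1ℚ) ℚ.+ p ℚ.* 1ℚ          ≡⟨ ℚₚ.*-distribˡ-+ p (ℚ.- 1ℚ) 1ℚ ⟨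
  p ℚ.* (ℚ.- 1ℚ ℚ.+ 1ℚ)                ≡⟨ ℚₚ.*-zeroʳ p ⟩
  0ℚ                                   ∎)
  where 2ℚ = 1ℚ ℚ.+ 1ℚ

-- The Fourier transform of a set

fourier : Subset d → Pt d → ℚ
fourier S v = ∑∈ S (χ v)

fourier-ε : (S : Subset d) → fourier S ε ≡ fromℕ (size S)
fourier-ε S = trans (∑∈-cong S λ x _ → χ-ε x) (∑∈-1 S)

∑-χ : (v : Pt d) → ∑ (χ v) ≡ (if does (v ≟ ε) then fromℕ (2 ^ d) else 0ℚ)
∑-χ {zero}  []          = refl
∑-χ {suc d} (false ∷ v) with v ≟ ε | ∑-χ v
... | yes _ | ∑χ≡2^d = begin
  ∑ (χ v) ℚ.+ ∑ (χ v)                  ≡⟨ cong₂ ℚ._+_ ∑χ≡2^d ∑χ≡2^d ⟩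
  fromℕ (2 ^ d) ℚ.+ fromℕ (2 ^ d)      ≡⟨ fromℕ-+ (2 ^ d) (2 ^ d) ⟨
  fromℕ (2 ^ d ℕ.+ 2 ^ d)              ≡⟨ cong (λ n → fromℕ (2 ^ d ℕ.+ n)) (ℕₚ.+-identityʳ (2 ^ d)) ⟨
  fromℕ (2 ^ suc d)                    ∎
... | no _  | ∑χ≡0   = cong₂ ℚ._+_ ∑χ≡0 ∑χ≡0
∑-χ {suc d} (true ∷ v)  =
  trans (sym (∑-+ (χ v) (λ x → sign (not (dot v x))))) (trans (∑-cong cancel) (∑-0 {d}))
  where
  cancel : ∀ x → χ v x ℚ.+ sign (not (dot v x)) ≡ 0ℚ
  cancel x with dot v x
  ... | false = refl
  ... | true  = refl

does-⊕≟ε : (x y : Pt d) → does ((x ⊕ y) ≟ ε) ≡ does (x ≟ y)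
does-⊕≟ε x y with x ≟ y
... | yes refl = dec-true ((x ⊕ x) ≟ ε) (⊕-self x)
... | no x≢y   = dec-false ((x ⊕ y) ≟ ε) (x≢y ∘ ⊕≡ε⇒≡ x y)

∑-χχ : (x y : Pt d) → ∑ (λ a → χ a x ℚ.* χ a y) ≡ (if does (x ≟ y) then fromℕ (2 ^ d) else 0ℚ)
∑-χχ {d} x y = begin
  ∑ (λ a → χ a x ℚ.* χ a y)                         ≡⟨ ∑-cong (λ a → trans (sym (χ-⊕ʳ a x y)) (χ-comm a (x ⊕ y))) ⟩
  ∑ (χ (x ⊕ y))                                     ≡⟨ ∑-χ (x ⊕ y) ⟩
  (if does ((x ⊕ y) ≟ ε) then fromℕ (2 ^ d) else 0ℚ) ≡⟨ cong (if_then fromℕ (2 ^ d) else 0ℚ) (does-⊕≟ε x y) ⟩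
  (if does (x ≟ y) then fromℕ (2 ^ d) else 0ℚ)       ∎

fourier-inversion : (F : Pt d → ℚ) (x : Pt d) →
  ∑ (λ a → ∑ (λ g → F g ℚ.* χ a g) ℚ.* χ a x) ≡ fromℕ (2 ^ d) ℚ.* F x
fourier-inversion {d} F x = begin
  ∑ (λ a → ∑ (λ g → F g ℚ.* χ a g) ℚ.* χ a x)
    ≡⟨ ∑-cong (λ a → trans (sym (∑-*ʳ (χ a x) (λ g → F g ℚ.* χ a g)))
                            (∑-cong λ g → ℚₚ.*-assoc (F g) (χ a g) (χ a x))) ⟩
  ∑ (λ a → ∑ (λ g → F g ℚ.* (χ a g ℚ.* χ a x)))
    ≡⟨ ∑-comm (λ a g → F g ℚ.* (χ a g ℚ.* χ a x)) ⟩
  ∑ (λ g → ∑ (λ a → F g ℚ.* (χ a g ℚ.* χ a x)))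
    ≡⟨ ∑-cong (λ g → ∑-*ˡ (F g) (λ a → χ a g ℚ.* χ a x)) ⟩
  ∑ (λ g → F g ℚ.* ∑ (λ a → χ a g ℚ.* χ a x))
    ≡⟨ ∑-cong (λ g → trans (cong (F g ℚ.*_) (∑-χχ g x)) (if-float (F g ℚ.*_) (does (g ≟ x)))) ⟩
  ∑ (λ g → if does (g ≟ x) then F g ℚ.* fromℕ (2 ^ d) else F g ℚ.* 0ℚ)
    ≡⟨ ∑-cong (λ g → cong (if does (g ≟ x) then F g ℚ.* fromℕ (2 ^ d) else_) (ℚₚ.*-zeroʳ (F g))) ⟩
  ∑ (λ g → if does (g ≟ x) then F g ℚ.* fromℕ (2 ^ d) else 0ℚ)
    ≡⟨ ∑-δ x (λ g → F g ℚ.* fromℕ (2 ^ d)) ⟩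
  F x ℚ.* fromℕ (2 ^ d)
    ≡⟨ ℚₚ.*-comm (F x) (fromℕ (2 ^ d)) ⟩
  fromℕ (2 ^ d) ℚ.* F x ∎

fourier-vanishing : (S : Subset d) → (∀ v → v ≢ ε → fourier S v ≡ 0ℚ) → size S ≡ 0 ⊎ size S ≡ 2 ^ d
fourier-vanishing {d} S vanishes = by-cases (S ε) counted
  where
  by-cases : (b : Bool) → fromℕ (size S) ≡ (if b then fromℕ (2 ^ d) else 0ℚ) → size S ≡ 0 ⊎ size S ≡ 2 ^ d
  by-cases true  eq = inj₂ (fromℕ-injective eq)
  by-cases false eq = inj₁ (fromℕ-injective eq)
  counted : fromℕ (size S) ≡ (if S ε then fromℕ (2 ^ d) else 0ℚ)
  counted = begin
    fromℕ (size S)                                      ≡⟨ fourier-ε S ⟨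
    fourier S ε                                         ≡⟨ ∑-δ ε (fourier S) ⟨
    ∑ (λ v → if does (v ≟ ε) then fourier S v else 0ℚ) ≡⟨ ∑-cong only-ε ⟩
    ∑ (fourier S)                                       ≡⟨ ∑-∑∈-comm S χ ⟩
    ∑∈ S (λ x → ∑ (λ v → χ v x))                        ≡⟨ ∑∈-cong S (λ x _ → trans (∑-cong λ v → χ-comm v x) (∑-χ x)) ⟩
    ∑∈ S (λ x → if does (x ≟ ε) then fromℕ (2 ^ d) else 0ℚ) ≡⟨ ∑∈-δ S ε (λ _ → fromℕ (2 ^ d)) ⟩
    (if S ε then fromℕ (2 ^ d) else 0ℚ)                 ∎
    where
    only-ε : ∀ v → (if does (v ≟ ε) then fourier S v else 0ℚ) ≡ fourier S v
    only-ε v with v ≟ ε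
    ... | yes _   = refl
    ... | no v≢ε  = sym (vanishes v v≢ε)

four-divides : (S : Subset d) (v w : Pt d) →
               fourier S v ≡ 0ℚ → fourier S w ≡ 0ℚ → fourier S (v ⊕ w) ≡ 0ℚ → 4 ∣ size S
four-divides S v w Ŝv≡0 Ŝw≡0 Ŝv⊕w≡0 =
  divides (ℕ∑.∑∈ S 𝟙K) (trans (fromℕ-injective counted) (ℕₚ.*-comm 4 (ℕ∑.∑∈ S 𝟙K)))
  where
  𝟙K : Pt _ → ℕ
  𝟙K x = if not (dot v x) ∧ not (dot w x) then 1 else 0
  -- 1 + χ v + χ w + χ (v ⊕ w) is 4 on the common kernel of v and w and 0 elsewhere.
  four-or-zero : ∀ x → ((χ ε x ℚ.+ χ v x) ℚ.+ χ w x) ℚ.+ χ (v ⊕ w) x ≡ fromℕ (4 ℕ.* 𝟙K x)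
  four-or-zero x rewrite χ-ε x | χ-⊕ˡ v w x with dot v x | dot w x
  ... | false | false = refl
  ... | false | true  = refl
  ... | true  | false = refl
  ... | true  | true  = refl
  counted : fromℕ (size S) ≡ fromℕ (4 ℕ.* ℕ∑.∑∈ S 𝟙K)
  counted = begin
    fromℕ (size S)
      ≡⟨ fourier-ε S ⟨
    fourier S ε
      ≡⟨ trans (ℚₚ.+-identityʳ _) (trans (ℚₚ.+-identityʳ _) (ℚₚ.+-identityʳ (fourier S ε))) ⟨
    fourier S ε ℚ.+ 0ℚ ℚ.+ 0ℚ ℚ.+ 0ℚ
      ≡⟨ cong₂ ℚ._+_ (cong₂ ℚ._+_ (cong (fourier S ε ℚ.+_) Ŝv≡0) Ŝw≡0) Ŝv⊕w≡0 ⟨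
    fourier S ε ℚ.+ fourier S v ℚ.+ fourier S w ℚ.+ fourier S (v ⊕ w)
      ≡⟨ cong (ℚ._+ fourier S (v ⊕ w)) (cong (ℚ._+ fourier S w) (∑∈-+ S (χ ε) (χ v))) ⟨
    ∑∈ S (λ x → χ ε x ℚ.+ χ v x) ℚ.+ fourier S w ℚ.+ fourier S (v ⊕ w)
      ≡⟨ cong (ℚ._+ fourier S (v ⊕ w)) (∑∈-+ S (λ x → χ ε x ℚ.+ χ v x) (χ w)) ⟨
    ∑∈ S (λ x → χ ε x ℚ.+ χ v x ℚ.+ χ w x) ℚ.+ fourier S (v ⊕ w)
      ≡⟨ ∑∈-+ S (λ x → χ ε x ℚ.+ χ v x ℚ.+ χ w x) (χ (v ⊕ w)) ⟨
    ∑∈ S (λ x → χ ε x ℚ.+ χ v x ℚ.+ χ w x ℚ.+ χ (v ⊕ w) x)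
      ≡⟨ ∑∈-cong S (λ x _ → four-or-zero x) ⟩
    ∑∈ S (λ x → fromℕ (4 ℕ.* 𝟙K x))
      ≡⟨ ∑∈-fromℕ S (λ x → 4 ℕ.* 𝟙K x) ⟩
    fromℕ (ℕ∑.∑∈ S (λ x → 4 ℕ.* 𝟙K x))
      ≡⟨ cong fromℕ (ℕ∑.∑∈-*ˡ S 4 𝟙K) ⟩
    fromℕ (4 ℕ.* ℕ∑.∑∈ S 𝟙K)
      ∎

fourier-⊥ : {H : Subset d} {a : Pt d} → a ∈ H ⊥ → fourier H a ≡ fromℕ (size H)
fourier-⊥ {H = H} {a} a∈H⊥ =
  trans (∑∈-cong H λ h h∈H → cong sign (⊥-orthogonal {H = H} {a} a∈H⊥ h∈H)) (∑∈-1 H)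

-- Translating by some h ∈ H with a·h = 1 negates Ĥ(a).
fourier-∉⊥ : {H : Subset d} {a : Pt d} → IsSubgroup H → (H ⊥) a ≡ false → fourier H a ≡ 0ℚ
fourier-∉⊥ {H = H} {a} (_ , closed) a∉H⊥ = p≡p*-1⇒p≡0 (fourier H a) (begin
  ∑ (λ x → if H x then χ a x else 0ℚ)
    ≡⟨ ∑-shift h (λ x → if H x then χ a x else 0ℚ) ⟨
  ∑ (λ x → if H (x ⊕ h) then χ a (x ⊕ h) else 0ℚ)
    ≡⟨ ∑-cong translate ⟩
  ∑∈ H (λ x → χ a x ℚ.* (ℚ.- 1ℚ))
    ≡⟨ ∑∈-*ʳ H (ℚ.- 1ℚ) (χ a) ⟩
  fourier H a ℚ.* (ℚ.- 1ℚ) ∎)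
  where
  h = proj₁ (⊥-witness {H = H} {a} a∉H⊥)
  h∈H = proj₁ (proj₂ (⊥-witness {H = H} {a} a∉H⊥))
  χah≡-1 : χ a h ≡ ℚ.- 1ℚ
  χah≡-1 = cong sign (proj₂ (proj₂ (⊥-witness {H = H} {a} a∉H⊥)))
  translate : ∀ x → (if H (x ⊕ h) then χ a (x ⊕ h) else 0ℚ) ≡ (if H x then χ a x ℚ.* (ℚ.- 1ℚ) else 0ℚ)
  translate x with H x in x∈H | H (x ⊕ h) in x⊕h∈H
  ... | true  | true  = trans (χ-⊕ʳ a x h) (cong (χ a x ℚ.*_) χah≡-1)
  ... | false | false = refl
  ... | true  | false = contradiction (trans (sym (closed x∈H h∈H)) x⊕h∈H) λ ()
  ... | false | true  =
    contradiction (trans (sym (closed x⊕h∈H h∈H)) (trans (cong H (⊕-cancelʳ x h)) x∈H)) λ ()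

-- Spectral pairs

sumOver≡∑∈ : (S : Subset d) (f : Pt d → ℚ) → sumOver S f ≡ ∑∈ S f
sumOver≡∑∈ S f = foldr-allPts (λ x → if S x then f x else 0ℚ)

ip-χ : (E : Subset d) (a b : Pt d) → ip E (χ a) (χ b) ≡ fourier E (a ⊕ b)
ip-χ E a b = trans (sumOver≡∑∈ E _) (∑∈-cong E λ x _ → sym (χ-⊕ˡ a b x))

record SpectralPair (E A : Subset d) : Set where
  field
    size-≡ : size A ≡ size E
    primal : ∀ {a b} → a ∈ A → b ∈ A → a ≢ b → fourier E (a ⊕ b) ≡ 0ℚ
    dual   : ∀ {x y} → x ∈ E → y ∈ E → x ≢ y → fourier A (x ⊕ y) ≡ 0ℚ

SpectralPair-sym : {E A : Subset d} → SpectralPair E A → SpectralPair A E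
SpectralPair-sym pair = record { size-≡ = sym size-≡ ; primal = dual ; dual = primal }
  where open SpectralPair pair

module Spectrum {E A : Subset d}
  (orthogonal : (a b : Pt d) → a ∈ A → b ∈ A → a ≢ b → ip E (χ a) (χ b) ≡ 0ℚ)
  (spanning : (f : Pt d → ℚ) → Σ (Pt d → ℚ) λ c →
              (x : Pt d) → x ∈ E → f x ≡ sumOver A (λ a → c a ℚ.* χ a x))
  where

  gram : {a b : Pt d} → a ∈ A → b ∈ A →
         ∑∈ E (λ x → χ a x ℚ.* χ b x) ≡ (if does (a ≟ b) then fromℕ (size E) else 0ℚ)
  gram {a} {b} a∈A b∈A with a ≟ b
  ... | yes refl = trans (∑∈-cong E λ x _ → χ-square a x) (∑∈-1 E)
  ... | no a≢b   = trans (sym (sumOver≡∑∈ E _)) (orthogonal a b a∈A b∈A a≢b)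

  coefficient-extraction : (c : Pt d → ℚ) {b : Pt d} → b ∈ A →
    ∑∈ E (λ x → ∑∈ A (λ a → c a ℚ.* χ a x) ℚ.* χ b x) ≡ c b ℚ.* fromℕ (size E)
  coefficient-extraction c {b} b∈A = begin
    ∑∈ E (λ x → ∑∈ A (λ a → c a ℚ.* χ a x) ℚ.* χ b x)
      ≡⟨ ∑∈-cong E (λ x _ → sym (∑∈-*ʳ A (χ b x) (λ a → c a ℚ.* χ a x))) ⟩
    ∑∈ E (λ x → ∑∈ A (λ a → c a ℚ.* χ a x ℚ.* χ b x))
      ≡⟨ ∑∈-comm E A (λ x a → c a ℚ.* χ a x ℚ.* χ b x) ⟩
    ∑∈ A (λ a → ∑∈ E (λ x → c a ℚ.* χ a x ℚ.* χ b x))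
      ≡⟨ ∑∈-cong A (λ a _ → trans (∑∈-cong E λ x _ → ℚₚ.*-assoc (c a) (χ a x) (χ b x))
                                  (∑∈-*ˡ E (c a) (λ x → χ a x ℚ.* χ b x))) ⟩
    ∑∈ A (λ a → c a ℚ.* ∑∈ E (λ x → χ a x ℚ.* χ b x))
      ≡⟨ ∑∈-cong A (λ a a∈A → trans (cong (c a ℚ.*_) (gram a∈A b∈A))
                                    (if-float (c a ℚ.*_) (does (a ≟ b)))) ⟩
    ∑∈ A (λ a → if does (a ≟ b) then c a ℚ.* fromℕ (size E) else c a ℚ.* 0ℚ)
      ≡⟨ ∑∈-cong A (λ a _ → cong (if does (a ≟ b) then c a ℚ.* fromℕ (size E) else_) (ℚₚ.*-zeroʳ (c a))) ⟩
    ∑∈ A (λ a → if does (a ≟ b) then c a ℚ.* fromℕ (size E) else 0ℚ)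
      ≡⟨ ∑∈-δ A b (λ a → c a ℚ.* fromℕ (size E)) ⟩
    (if A b then c b ℚ.* fromℕ (size E) else 0ℚ)
      ≡⟨ cong (if_then c b ℚ.* fromℕ (size E) else 0ℚ) b∈A ⟩
    c b ℚ.* fromℕ (size E)
      ∎

  δ : Pt d → Pt d → ℚ
  δ y x = if does (x ≟ y) then 1ℚ else 0ℚ

  δ-* : (y x : Pt d) (q : ℚ) → δ y x ℚ.* q ≡ (if does (x ≟ y) then q else 0ℚ)
  δ-* y x q with does (x ≟ y)
  ... | true  = ℚₚ.*-identityˡ q
  ... | false = ℚₚ.*-zeroˡ q

  coefficient : (y : Pt d) {b : Pt d} → y ∈ E → b ∈ A →
                proj₁ (spanning (δ y)) b ℚ.* fromℕ (size E) ≡ χ b y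
  coefficient y {b} y∈E b∈A = begin
    c b ℚ.* fromℕ (size E)
      ≡⟨ coefficient-extraction c b∈A ⟨
    ∑∈ E (λ x → ∑∈ A (λ a → c a ℚ.* χ a x) ℚ.* χ b x)
      ≡⟨ ∑∈-cong E (λ x x∈E → cong (ℚ._* χ b x) (sym (trans (expand x x∈E) (sumOver≡∑∈ A _)))) ⟩
    ∑∈ E (λ x → δ y x ℚ.* χ b x)
      ≡⟨ ∑∈-cong E (λ x _ → δ-* y x (χ b x)) ⟩
    ∑∈ E (λ x → if does (x ≟ y) then χ b x else 0ℚ)
      ≡⟨ ∑∈-δ E y (χ b) ⟩
    (if E y then χ b y else 0ℚ)
      ≡⟨ cong (if_then χ b y else 0ℚ) y∈E ⟩
    χ b y ∎
    where
    c = proj₁ (spanning (δ y))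
    expand = proj₂ (spanning (δ y))

  -- The columns of the character table (χ a x), a ∈ A, x ∈ E, are orthogonal as well.
  dual-expansion : {x y : Pt d} → x ∈ E → y ∈ E → fromℕ (size E) ℚ.* δ y x ≡ fourier A (x ⊕ y)
  dual-expansion {x} {y} x∈E y∈E = begin
    fromℕ (size E) ℚ.* δ y x
      ≡⟨ cong (fromℕ (size E) ℚ.*_) (trans (expand x x∈E) (sumOver≡∑∈ A _)) ⟩
    fromℕ (size E) ℚ.* ∑∈ A (λ a → c a ℚ.* χ a x)
      ≡⟨ ∑∈-*ˡ A (fromℕ (size E)) (λ a → c a ℚ.* χ a x) ⟨
    ∑∈ A (λ a → fromℕ (size E) ℚ.* (c a ℚ.* χ a x))
      ≡⟨ ∑∈-cong A (λ a a∈A → term a a∈A) ⟩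
    fourier A (x ⊕ y) ∎
    where
    c = proj₁ (spanning (δ y))
    expand = proj₂ (spanning (δ y))
    term : (a : Pt d) → a ∈ A → fromℕ (size E) ℚ.* (c a ℚ.* χ a x) ≡ χ (x ⊕ y) a
    term a a∈A = begin
      fromℕ (size E) ℚ.* (c a ℚ.* χ a x)  ≡⟨ ℚₚ.*-assoc (fromℕ (size E)) (c a) (χ a x) ⟨
      fromℕ (size E) ℚ.* c a ℚ.* χ a x    ≡⟨ cong (ℚ._* χ a x) (ℚₚ.*-comm (fromℕ (size E)) (c a)) ⟩
      c a ℚ.* fromℕ (size E) ℚ.* χ a x    ≡⟨ cong (ℚ._* χ a x) (coefficient y y∈E a∈A) ⟩
      χ a y ℚ.* χ a x                     ≡⟨ χ-⊕ʳ a y x ⟨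
      χ a (y ⊕ x)                         ≡⟨ trans (χ-comm a (y ⊕ x)) (cong (λ z → χ z a) (⊕-comm y x)) ⟩
      χ (x ⊕ y) a                         ∎

  pair : (x₀ : Pt d) → x₀ ∈ E → SpectralPair E A
  pair x₀ x₀∈E = record
    { size-≡ = fromℕ-injective (begin
        fromℕ (size A)              ≡⟨ fourier-ε A ⟨
        fourier A ε                 ≡⟨ cong (fourier A) (⊕-self x₀) ⟨
        fourier A (x₀ ⊕ x₀)         ≡⟨ dual-expansion x₀∈E x₀∈E ⟨
        fromℕ (size E) ℚ.* δ x₀ x₀  ≡⟨ cong (λ b → fromℕ (size E) ℚ.* (if b then 1ℚ else 0ℚ))
                                              (dec-true (x₀ ≟ x₀) refl) ⟩
        fromℕ (size E) ℚ.* 1ℚ       ≡⟨ ℚₚ.*-identityʳ (fromℕ (size E)) ⟩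
        fromℕ (size E)              ∎)
    ; primal = λ {a} {b} a∈A b∈A a≢b → trans (sym (ip-χ E a b)) (orthogonal a b a∈A b∈A a≢b)
    ; dual = λ {x} {y} x∈E y∈E x≢y → begin
        fourier A (x ⊕ y)           ≡⟨ dual-expansion x∈E y∈E ⟨
        fromℕ (size E) ℚ.* δ y x    ≡⟨ cong (λ b → fromℕ (size E) ℚ.* (if b then 1ℚ else 0ℚ))
                                              (dec-false (x ≟ y) x≢y) ⟩
        fromℕ (size E) ℚ.* 0ℚ       ≡⟨ ℚₚ.*-zeroʳ (fromℕ (size E)) ⟩
        0ℚ                          ∎
    }

spectral⇒pair : {E : Subset d} → Nonempty E → Spectral E → Σ (Subset d) (SpectralPair E)
spectral⇒pair (x₀ , x₀∈E) (A , orthogonal , spanning) = A , Spectrum.pair orthogonal spanning x₀ x₀∈E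

pair-cover-size : {E A : Subset d} → SpectralPair E A → DifferencesCover E → size E ≡ 0 ⊎ size E ≡ 2 ^ d
pair-cover-size {d} {E} {A} pair cover =
  subst (λ k → k ≡ 0 ⊎ k ≡ 2 ^ d) size-≡ (fourier-vanishing A vanishes)
  where
  open SpectralPair pair
  vanishes : ∀ v → v ≢ ε → fourier A v ≡ 0ℚ
  vanishes v v≢ε =
    let x , x∈E , x⊕v∈E = cover v in
    subst (λ w → fourier A w ≡ 0ℚ) (⊕-cancelˡ x v) (dual x∈E x⊕v∈E (≢-translate v≢ε))

large-sets-cover : (A : Subset d) → 2 ^ d ℕ.< size A ℕ.+ size A → DifferencesCover A
large-sets-cover {d} A large v with anyPt (λ x → A x ∧ A (x ⊕ v)) in found
... | true  = let x , both = anyPt-true _ found in x , ∧-conicalˡ _ _ both , ∧-conicalʳ _ _ both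
... | false =
  contradiction (subst (ℕ._≤ 2 ^ d) disjoint-union (size-≤ (λ x → A x ∨ A (x ⊕ v)))) (ℕₚ.<⇒≱ large)
  where
  disjoint-union : size (λ x → A x ∨ A (x ⊕ v)) ≡ size A ℕ.+ size A
  disjoint-union =
    trans (size-∨ A (λ x → A (x ⊕ v)) (anyPt-false _ found)) (cong (size A ℕ.+_) (size-shift A v))

pair-four-divides : {E A : Subset d} → SpectralPair E A → 3 ℕ.≤ size A → 4 ∣ size E
pair-four-divides {E = E} {A} pair 3≤|A| =
  let a , b , c , (a∈A , b∈A , c∈A) , (b≢a , c≢a , c≢b) = three-elements A 3≤|A|
  in four-divides E (a ⊕ b) (a ⊕ c) (primal a∈A b∈A (≢-sym b≢a)) (primal a∈A c∈A (≢-sym c≢a))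
       (subst (λ v → fourier E v ≡ 0ℚ) (sym (⊕-difference a b c)) (primal b∈A c∈A (≢-sym c≢b)))
  where open SpectralPair pair

spectral-cover-size : {E : Subset d} → Nonempty E → Spectral E → DifferencesCover E → size E ≡ 2 ^ d
spectral-cover-size {E = E} (x , x∈E) spectral cover =
  fromInj₂ (λ size≡0 → contradiction size≡0 (ℕₚ.>⇒≢ (size-positive E x∈E)))
           (pair-cover-size (proj₂ (spectral⇒pair (x , x∈E) spectral)) cover)

-- Tilings

module Tiled {E T : Subset d} (tiles : Tiles E T) where

  -- g ⊕ τ g is the point of E in the translate of E that contains g.
  τ : Pt d → Pt d
  τ g = proj₁ (tiles g)

  τ-unique : {y t : Pt d} → y ∈ E → t ∈ T → τ (y ⊕ t) ≡ t
  τ-unique {y} {t} y∈E t∈T =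
    sym (proj₂ (proj₂ (tiles (y ⊕ t))) t t∈T (subst (_∈ E) (sym (⊕-cancelʳ y t)) y∈E))

  fourier-periodic-extension : (f : Pt d → ℚ) (a : Pt d) →
    ∑ (λ g → f (g ⊕ τ g) ℚ.* χ a g) ≡ ∑∈ E (λ y → f y ℚ.* χ a y) ℚ.* fourier T a
  fourier-periodic-extension f a = begin
    ∑ (λ g → f (g ⊕ τ g) ℚ.* χ a g)
      ≡⟨ ∑-tiling tiles (λ g → f (g ⊕ τ g) ℚ.* χ a g) ⟩
    ∑∈ T (λ t → ∑∈ E (λ y → f ((y ⊕ t) ⊕ τ (y ⊕ t)) ℚ.* χ a (y ⊕ t)))
      ≡⟨ ∑∈-cong T (λ t t∈T → ∑∈-cong E λ y y∈E → term y∈E t∈T) ⟩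
    ∑∈ T (λ t → ∑∈ E (λ y → f y ℚ.* χ a y ℚ.* χ a t))
      ≡⟨ ∑∈-cong T (λ t _ → ∑∈-*ʳ E (χ a t) (λ y → f y ℚ.* χ a y)) ⟩
    ∑∈ T (λ t → ∑∈ E (λ y → f y ℚ.* χ a y) ℚ.* χ a t)
      ≡⟨ ∑∈-*ˡ T (∑∈ E (λ y → f y ℚ.* χ a y)) (χ a) ⟩
    ∑∈ E (λ y → f y ℚ.* χ a y) ℚ.* fourier T a ∎
    where
    term : {y t : Pt d} → y ∈ E → t ∈ T →
           f ((y ⊕ t) ⊕ τ (y ⊕ t)) ℚ.* χ a (y ⊕ t) ≡ f y ℚ.* χ a y ℚ.* χ a t
    term {y} {t} y∈E t∈T = begin
      f ((y ⊕ t) ⊕ τ (y ⊕ t)) ℚ.* χ a (y ⊕ t)  ≡⟨ cong (λ s → f ((y ⊕ t) ⊕ s) ℚ.* χ a (y ⊕ t)) (τ-unique y∈E t∈T) ⟩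
      f ((y ⊕ t) ⊕ t) ℚ.* χ a (y ⊕ t)          ≡⟨ cong₂ ℚ._*_ (cong f (⊕-cancelʳ y t)) (χ-⊕ʳ a y t) ⟩
      f y ℚ.* (χ a y ℚ.* χ a t)                ≡⟨ ℚₚ.*-assoc (f y) (χ a y) (χ a t) ⟨
      f y ℚ.* χ a y ℚ.* χ a t                  ∎

  convolution : (a : Pt d) → ∑ (χ a) ≡ fourier E a ℚ.* fourier T a
  convolution a = begin
    ∑ (χ a)                                      ≡⟨ ∑-cong (λ g → ℚₚ.*-identityˡ (χ a g)) ⟨
    ∑ (λ g → 1ℚ ℚ.* χ a g)                        ≡⟨ fourier-periodic-extension (λ _ → 1ℚ) a ⟩
    ∑∈ E (λ y → 1ℚ ℚ.* χ a y) ℚ.* fourier T a     ≡⟨ cong (ℚ._* fourier T a) (∑∈-cong E λ y _ → ℚₚ.*-identityˡ (χ a y)) ⟩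
    fourier E a ℚ.* fourier T a                   ∎

  periodic-extension-on-E : (f : Pt d → ℚ) {x : Pt d} → ε ∈ T → x ∈ E → f (x ⊕ τ x) ≡ f x
  periodic-extension-on-E f {x} ε∈T x∈E =
    cong f (trans (cong (x ⊕_) (trans (cong τ (sym (⊕-identityʳ x))) (τ-unique x∈E ε∈T))) (⊕-identityʳ x))

-- The spectrum is H ⊥: f is expanded through its H-periodic extension g ↦ f (g ⊕ τ g), whose
-- Fourier transform vanishes off H ⊥.
subgroup-tiling⇒spectral : {E H : Subset d} → IsSubgroup H → Tiles E H → Spectral E
subgroup-tiling⇒spectral {d} {E} {H} subgroup@(ε∈H , _) tiles = H ⊥ , orthogonal , spanning
  where
  open Tiled {d} {E} {H} tiles

  orthogonal : (a b : Pt d) → a ∈ H ⊥ → b ∈ H ⊥ → a ≢ b → ip E (χ a) (χ b) ≡ 0ℚ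
  orthogonal a b a∈H⊥ b∈H⊥ a≢b = trans (ip-χ E a b) (p*q≡0⇒p≡0 _ _ Ĥ≢0 Ê·Ĥ≡0)
    where
    Ĥ≢0 : fourier H (a ⊕ b) ≢ 0ℚ
    Ĥ≢0 = fromℕ≢0 (size-positive H ε∈H)
        ∘ trans (sym (fourier-⊥ {H = H} {a ⊕ b} (⊥-closed {H = H} {a} {b} a∈H⊥ b∈H⊥)))
    Ê·Ĥ≡0 : fourier E (a ⊕ b) ℚ.* fourier H (a ⊕ b) ≡ 0ℚ
    Ê·Ĥ≡0 = begin
      fourier E (a ⊕ b) ℚ.* fourier H (a ⊕ b)            ≡⟨ convolution (a ⊕ b) ⟨
      ∑ (χ (a ⊕ b))                                      ≡⟨ ∑-χ (a ⊕ b) ⟩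
      (if does ((a ⊕ b) ≟ ε) then fromℕ (2 ^ d) else 0ℚ) ≡⟨ cong (if_then fromℕ (2 ^ d) else 0ℚ)
                                                                 (dec-false ((a ⊕ b) ≟ ε) (a≢b ∘ ⊕≡ε⇒≡ a b)) ⟩
      0ℚ                                                 ∎

  N : ℚ
  N = fromℕ (2 ^ d)
  instance
    N≢0 : ℚ.NonZero N
    N≢0 = ℚ.≢-nonZero (fromℕ≢0 (ℕₚ.m^n>0 2 d))

  spanning : (f : Pt d → ℚ) → Σ (Pt d → ℚ) λ c →
             (x : Pt d) → x ∈ E → f x ≡ sumOver (H ⊥) (λ a → c a ℚ.* χ a x)
  spanning f = c , expansion
    where
    F̂ : Pt d → ℚ
    F̂ a = ∑ (λ g → f (g ⊕ τ g) ℚ.* χ a g)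
    c : Pt d → ℚ
    c a = ℚ.1/ N ℚ.* F̂ a
    expansion : (x : Pt d) → x ∈ E → f x ≡ sumOver (H ⊥) (λ a → c a ℚ.* χ a x)
    expansion x x∈E = sym (begin
      sumOver (H ⊥) (λ a → c a ℚ.* χ a x)
        ≡⟨ sumOver≡∑∈ (H ⊥) (λ a → c a ℚ.* χ a x) ⟩
      ∑∈ (H ⊥) (λ a → c a ℚ.* χ a x)
        ≡⟨ ∑∈-full {S = H ⊥} outside-⊥ ⟩
      ∑ (λ a → ℚ.1/ N ℚ.* F̂ a ℚ.* χ a x)
        ≡⟨ ∑-cong (λ a → ℚₚ.*-assoc (ℚ.1/ N) (F̂ a) (χ a x)) ⟩
      ∑ (λ a → ℚ.1/ N ℚ.* (F̂ a ℚ.* χ a x))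
        ≡⟨ ∑-*ˡ (ℚ.1/ N) (λ a → F̂ a ℚ.* χ a x) ⟩
      ℚ.1/ N ℚ.* ∑ (λ a → F̂ a ℚ.* χ a x)
        ≡⟨ cong (ℚ.1/ N ℚ.*_) (fourier-inversion (λ g → f (g ⊕ τ g)) x) ⟩
      ℚ.1/ N ℚ.* (N ℚ.* f (x ⊕ τ x))
        ≡⟨ ℚₚ.*-assoc (ℚ.1/ N) N (f (x ⊕ τ x)) ⟨
      ℚ.1/ N ℚ.* N ℚ.* f (x ⊕ τ x)
        ≡⟨ cong (ℚ._* f (x ⊕ τ x)) (ℚₚ.*-inverseˡ N) ⟩
      1ℚ ℚ.* f (x ⊕ τ x)
        ≡⟨ ℚₚ.*-identityˡ (f (x ⊕ τ x)) ⟩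
      f (x ⊕ τ x)
        ≡⟨ periodic-extension-on-E f ε∈H x∈E ⟩
      f x ∎)
      where
      outside-⊥ : ∀ a → (H ⊥) a ≡ false → c a ℚ.* χ a x ≡ 0ℚ
      outside-⊥ a a∉H⊥ = begin
        ℚ.1/ N ℚ.* F̂ a ℚ.* χ a x
          ≡⟨ cong (λ z → ℚ.1/ N ℚ.* z ℚ.* χ a x) (fourier-periodic-extension f a) ⟩
        ℚ.1/ N ℚ.* (∑∈ E (λ y → f y ℚ.* χ a y) ℚ.* fourier H a) ℚ.* χ a x
          ≡⟨ cong (λ z → ℚ.1/ N ℚ.* (∑∈ E (λ y → f y ℚ.* χ a y) ℚ.* z) ℚ.* χ a x)
                  (fourier-∉⊥ {H = H} {a} subgroup a∉H⊥) ⟩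
        ℚ.1/ N ℚ.* (∑∈ E (λ y → f y ℚ.* χ a y) ℚ.* 0ℚ) ℚ.* χ a x
          ≡⟨ cong (λ z → ℚ.1/ N ℚ.* z ℚ.* χ a x) (ℚₚ.*-zeroʳ (∑∈ E (λ y → f y ℚ.* χ a y))) ⟩
        ℚ.1/ N ℚ.* 0ℚ ℚ.* χ a x
          ≡⟨ cong (ℚ._* χ a x) (ℚₚ.*-zeroʳ (ℚ.1/ N)) ⟩
        0ℚ ℚ.* χ a x
          ≡⟨ ℚₚ.*-zeroˡ (χ a x) ⟩
        0ℚ ∎

tiling-cover-full : {E T : Subset d} → Tiles E T → DifferencesCover E → ∀ y → y ∈ E
tiling-cover-full {E = E} {T} tiles cover y =
  let t , (t∈T , y⊕t₀⊕t∈E) , _ = tiles (y ⊕ t₀) in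
  subst (_∈ E) (trans (cong ((y ⊕ t₀) ⊕_) (T-singleton t∈T t₀∈T)) (⊕-cancelʳ y t₀)) y⊕t₀⊕t∈E
  where
  t₀ = proj₁ (tiles ε)
  t₀∈T = proj₁ (proj₁ (proj₂ (tiles ε)))
  T-singleton : ∀ {t t′} → t ∈ T → t′ ∈ T → t ≡ t′
  T-singleton {t} {t′} t∈T t′∈T =
    let x , x∈E , x⊕t⊕t′∈E = cover (t ⊕ t′)
        z = x ⊕ t
        unique = proj₂ (proj₂ (tiles z))
    in trans (unique t t∈T (subst (_∈ E) (sym (⊕-cancelʳ x t)) x∈E))
             (sym (unique t′ t′∈T (subst (_∈ E) (sym (⊕-assoc x t t′)) x⊕t⊕t′∈E)))

data Obstruction (E : Subset d) : Set where
  size∤ : ¬ (size E ∣ 2 ^ d) → Obstruction E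
  differences-cover : size E ≢ 2 ^ d → DifferencesCover E → Obstruction E

obstruction⇒¬tiling : {E : Subset d} → Obstruction E → ¬ Tiling E
obstruction⇒¬tiling (size∤ ∤)                  tiling = ∤ (tiling-size-∣ tiling)
obstruction⇒¬tiling {E = E} (differences-cover ≢2^d cover) (T , tiles) =
  ≢2^d (size-all E (tiling-cover-full tiles cover))

member : List (Pt d) → Subset d
member L x = does (Any.any? (x ≟_) L)

member⁺ : (L : List (Pt d)) {x : Pt d} → x ∈ₗ L → x ∈ member L
member⁺ L {x} = dec-true (Any.any? (x ≟_) L)

member⁻ : (L : List (Pt d)) {x : Pt d} → x ∈ member L → x ∈ₗ L
member⁻ L {x} x∈L with Any.any? (x ≟_) L
... | yes x∈ₗL = x∈ₗL

span : List (Pt d) → List (Pt d)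
span []       = ε ∷ []
span (g ∷ gs) = span gs ++ List.map (g ⊕_) (span gs)

⟨_⟩ : List (Pt d) → Subset d
⟨ gs ⟩ = member (span gs)

ε∈span : (gs : List (Pt d)) → ε ∈ₗ span gs
ε∈span []       = here refl
ε∈span (g ∷ gs) = ∈-++⁺ˡ (ε∈span gs)

span-closed : (gs : List (Pt d)) {x y : Pt d} → x ∈ₗ span gs → y ∈ₗ span gs → (x ⊕ y) ∈ₗ span gs
span-closed []       (here refl) (here refl) = here (⊕-self ε)
span-closed (g ∷ gs) {x} {y} x∈ y∈ with ∈-++⁻ (span gs) x∈ | ∈-++⁻ (span gs) y∈
... | inj₁ x∈S | inj₁ y∈S = ∈-++⁺ˡ (span-closed gs x∈S y∈S)
... | inj₁ x∈S | inj₂ y∈g⊕S =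
  let s , s∈S , y≡g⊕s = ∈-map⁻ (g ⊕_) y∈g⊕S in
  ∈-++⁺ʳ (span gs) (subst (_∈ₗ List.map (g ⊕_) (span gs))
                          (sym (trans (cong (x ⊕_) y≡g⊕s) (⊕-left-comm x g s)))
                          (∈-map⁺ (g ⊕_) (span-closed gs x∈S s∈S)))
... | inj₂ x∈g⊕S | inj₁ y∈S =
  let s , s∈S , x≡g⊕s = ∈-map⁻ (g ⊕_) x∈g⊕S in
  ∈-++⁺ʳ (span gs) (subst (_∈ₗ List.map (g ⊕_) (span gs))
                          (sym (trans (cong (_⊕ y) x≡g⊕s) (⊕-assoc g s y)))
                          (∈-map⁺ (g ⊕_) (span-closed gs s∈S y∈S)))
... | inj₂ x∈g⊕S | inj₂ y∈g⊕S =
  let s , s∈S , x≡g⊕s = ∈-map⁻ (g ⊕_) x∈g⊕S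
      s′ , s′∈S , y≡g⊕s′ = ∈-map⁻ (g ⊕_) y∈g⊕S in
  ∈-++⁺ˡ (subst (_∈ₗ span gs) (sym (trans (cong₂ _⊕_ x≡g⊕s y≡g⊕s′) (⊕-difference g s s′)))
                (span-closed gs s∈S s′∈S))

span-isSubgroup : (gs : List (Pt d)) → IsSubgroup ⟨ gs ⟩
span-isSubgroup gs = member⁺ (span gs) (ε∈span gs) , λ {x} {y} x∈ y∈ →
  member⁺ (span gs) (span-closed gs (member⁻ (span gs) {x} x∈) (member⁻ (span gs) {y} y∈))

full-tiles : (E : Subset d) → (∀ y → y ∈ E) → Tiles E ⟨ [] ⟩
full-tiles {d} E full y =
  ε , (proj₁ (span-isSubgroup {d} []) , full (y ⊕ ε)) , λ t′ t′∈ _ → only-ε (member⁻ (span []) {t′} t′∈)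
  where
  only-ε : ∀ {t′} → t′ ∈ₗ span {d} [] → t′ ≡ ε
  only-ε (here t′≡ε) = t′≡ε

t∈⟨t⟩ : (t : Pt d) → t ∈ ⟨ t ∷ [] ⟩
t∈⟨t⟩ t = member⁺ (span (t ∷ [])) (there (here (sym (⊕-identityʳ t))))

∈⟨t⟩ : {t x : Pt d} → x ∈ ⟨ t ∷ [] ⟩ → x ≡ ε ⊎ x ≡ t
∈⟨t⟩ {t = t} {x} x∈ with member⁻ (span (t ∷ [])) {x} x∈
... | here x≡ε           = inj₁ x≡ε
... | there (here x≡t⊕ε) = inj₂ (trans x≡t⊕ε (⊕-identityʳ t))

gap-tiles : (E : Subset d) (t : Pt d) → size E ℕ.+ size E ≡ 2 ^ d →
            (∀ x → (E x ∧ E (x ⊕ t)) ≡ false) → Tiles E ⟨ t ∷ [] ⟩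
gap-tiles {d} E t half gap y with E y in y∈E | E (y ⊕ t) in y⊕t∈E
... | true  | _     = ε , (proj₁ (span-isSubgroup (t ∷ [])) , subst (_∈ E) (sym (⊕-identityʳ y)) y∈E) , only-ε
  where
  only-ε : ∀ t′ → t′ ∈ ⟨ t ∷ [] ⟩ → (y ⊕ t′) ∈ E → t′ ≡ ε
  only-ε t′ t′∈ y⊕t′∈E with ∈⟨t⟩ {t = t} {t′} t′∈
  ... | inj₁ t′≡ε = t′≡ε
  ... | inj₂ refl = contradiction (trans (sym (gap y)) (cong₂ _∧_ y∈E y⊕t′∈E)) λ ()
... | false | true  = t , (t∈⟨t⟩ t , y⊕t∈E) , only-t
  where
  only-t : ∀ t′ → t′ ∈ ⟨ t ∷ [] ⟩ → (y ⊕ t′) ∈ E → t′ ≡ t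
  only-t t′ t′∈ y⊕t′∈E with ∈⟨t⟩ {t = t} {t′} t′∈
  ... | inj₁ refl = contradiction (trans (sym y∈E) (subst (_∈ E) (⊕-identityʳ y) y⊕t′∈E)) λ ()
  ... | inj₂ t′≡t = t′≡t
... | false | false =
  contradiction half (ℕₚ.<⇒≢ (subst (ℕ._< 2 ^ d) disjoint-union (size-< (λ x → E x ∨ E (x ⊕ t)) y neither)))
  where
  neither : (E y ∨ E (y ⊕ t)) ≡ false
  neither = cong₂ _∨_ y∈E y⊕t∈E
  disjoint-union : size (λ x → E x ∨ E (x ⊕ t)) ≡ size E ℕ.+ size E
  disjoint-union = trans (size-∨ E (λ x → E (x ⊕ t)) gap) (cong (size E ℕ.+_) (size-shift E t))

Tiles-translate : {E E′ H : Subset d} (u : Pt d) → (∀ x → E′ x ≡ E (x ⊕ u)) → Tiles E′ H → Tiles E H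
Tiles-translate {E = E} {E′} {H} u E′≗E+u tiles y =
  let t , (t∈H , y⊕u⊕t∈E′) , unique = tiles (y ⊕ u) in
  t , (t∈H , subst (_∈ E) (shuffle t) (trans (sym (E′≗E+u _)) y⊕u⊕t∈E′)) ,
  λ t′ t′∈H y⊕t′∈E → unique t′ t′∈H (trans (E′≗E+u _) (subst (_∈ E) (sym (shuffle t′)) y⊕t′∈E))
  where
  shuffle : ∀ t → ((y ⊕ u) ⊕ t) ⊕ u ≡ y ⊕ t
  shuffle t = begin
    ((y ⊕ u) ⊕ t) ⊕ u  ≡⟨ cong (_⊕ u) (⊕-assoc y u t) ⟩
    (y ⊕ (u ⊕ t)) ⊕ u  ≡⟨ cong (λ z → (y ⊕ z) ⊕ u) (⊕-comm u t) ⟩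
    (y ⊕ (t ⊕ u)) ⊕ u  ≡⟨ cong (_⊕ u) (⊕-assoc y t u) ⟨
    ((y ⊕ t) ⊕ u) ⊕ u  ≡⟨ ⊕-cancelʳ (y ⊕ t) u ⟩
    y ⊕ t              ∎

tilesᵇ : Subset d → List (Pt d) → Bool
tilesᵇ E L = allPt λ y → List.length (List.filter (λ t → E (y ⊕ t) ≟ᵇ true) L) ℕ.≡ᵇ 1

filter-singleton : {A : Set} {P : A → Set} (P? : Decidable P) (L : List A) →
  List.length (List.filter P? L) ≡ 1 → ∃ λ t → (t ∈ₗ L × P t) × (∀ t′ → t′ ∈ₗ L → P t′ → t′ ≡ t)
filter-singleton P? L length≡1 with List.filter P? L in filtered | length≡1
... | t ∷ [] | _ = t , ∈-filter⁻ P? (subst (t ∈ₗ_) (sym filtered) (here refl)) , only-t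
  where
  only-t : ∀ t′ → t′ ∈ₗ L → _ → t′ ≡ t
  only-t t′ t′∈L Pt′ with subst (t′ ∈ₗ_) filtered (∈-filter⁺ P? t′∈L Pt′)
  ... | here t′≡t = t′≡t

tilesᵇ-sound : (E : Subset d) (L : List (Pt d)) → tilesᵇ E L ≡ true → Tiles E (member L)
tilesᵇ-sound E L ok y =
  let t , (t∈L , y⊕t∈E) , unique = filter-singleton (λ t → E (y ⊕ t) ≟ᵇ true) L
                                      (ℕₚ.≡ᵇ⇒≡ _ 1 (Equivalence.from T-≡ (allPt-true _ ok y)))
  in t , (member⁺ L t∈L , y⊕t∈E) , λ t′ t′∈L y⊕t′∈E → unique t′ (member⁻ L {t′} t′∈L) y⊕t′∈E

sublists : {A : Set} → ℕ → List A → List (List A)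
sublists zero    _        = [] ∷ []
sublists (suc n) []       = []
sublists (suc n) (x ∷ xs) = List.map (x ∷_) (sublists n xs) ++ sublists (suc n) xs

filter∈sublists : {A : Set} {P : A → Set} (P? : Decidable P) (xs : List A) →
                  List.filter P? xs ∈ₗ sublists (List.length (List.filter P? xs)) xs
filter∈sublists P? []       = here refl
filter∈sublists P? (x ∷ xs) with does (P? x)
... | true  = ∈-++⁺ˡ (∈-map⁺ (x ∷_) (filter∈sublists P? xs))
... | false with List.filter P? xs | filter∈sublists P? xs
...   | []    | _      = here refl
...   | y ∷ ys | ys∈ = ∈-++⁺ʳ _ ys∈

allPts-complete : (x : Pt d) → x ∈ₗ allPts d
allPts-complete []          = here refl
allPts-complete (false ∷ x) = ∈-++⁺ˡ (∈-map⁺ (false ∷_) (allPts-complete x))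
allPts-complete (true ∷ x)  = ∈-++⁺ʳ _ (∈-map⁺ (true ∷_) (allPts-complete x))

elements : Subset d → List (Pt d)
elements {d} S = List.filter (λ x → S x ≟ᵇ true) (allPts d)

member-elements : (S : Subset d) (x : Pt d) → member (elements S) x ≡ S x
member-elements {d} S x with S x in x∈S
... | true  = member⁺ (elements S) (∈-filter⁺ (λ x → S x ≟ᵇ true) (allPts-complete x) x∈S)
... | false = dec-false (Any.any? (x ≟_) (elements S))
                (λ x∈ → contradiction (trans (sym x∈S) (proj₂ (∈-filter⁻ (λ x → S x ≟ᵇ true) {xs = allPts d} x∈)))
                                      λ ())

length-elements : (S : Subset d) → List.length (elements S) ≡ size S
length-elements {d} S = trans (counted (allPts d)) (ℕ∑.foldr-allPts (λ x → if S x then 1 else 0))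
  where
  counted : (xs : List (Pt d)) →
            List.length (List.filter (λ x → S x ≟ᵇ true) xs) ≡ List.foldr (λ x n → (if S x then 1 else 0) ℕ.+ n) 0 xs
  counted []       = refl
  counted (x ∷ xs) with S x
  ... | true  = cong suc (counted xs)
  ... | false = counted xs

all-true : {A : Set} (p : A → Bool) (xs : List A) → all p xs ≡ true → ∀ {x} → x ∈ₗ xs → p x ≡ true
all-true p xs ok x∈ = Equivalence.to T-≡ (All.lookup (all⁺ p xs (Equivalence.from T-≡ ok)) x∈)

any-true : {A : Set} (p : A → Bool) (xs : List A) → any p xs ≡ true → ∃ λ x → p x ≡ true
any-true p xs ok =
  let x , px = Any.satisfied (any⁻ p xs (Equivalence.from T-≡ ok)) in x , Equivalence.to T-≡ px

-- Dimension four

powers-of-two : List ℕ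
powers-of-two = 1 ∷ 2 ∷ 4 ∷ 8 ∷ 16 ∷ []

divisor-of-16 : {k : ℕ} → k ∣ 16 → k ∈ₗ powers-of-two
divisor-of-16 k∣16 =
  from-yes (ℕₚ.allUpTo? (λ k → k ∣? 16 →-dec Any.any? (k ℕ.≟_) powers-of-two) 17) (ℕ.s≤s (∣⇒≤ k∣16)) k∣16

spectral-size-∣ : {E : Subset 4} → Nonempty E → Spectral E → size E ∣ 16
spectral-size-∣ {E} nonempty spectral =
  size-arithmetic (ℕ.s≤s (size-≤ E)) (size-positive E (proj₂ nonempty)) size≥3⇒4∣size size>8⇒size≡0∨16
  where
  A = proj₁ (spectral⇒pair nonempty spectral)
  pair = proj₂ (spectral⇒pair nonempty spectral)
  open SpectralPair pair
  size≥3⇒4∣size : 3 ℕ.≤ size E → 4 ∣ size E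
  size≥3⇒4∣size 3≤|E| = pair-four-divides pair (subst (3 ℕ.≤_) (sym size-≡) 3≤|E|)
  size>8⇒size≡0∨16 : 16 ℕ.< size E ℕ.+ size E → size E ≡ 0 ⊎ size E ≡ 16
  size>8⇒size≡0∨16 large =
    subst (λ k → k ≡ 0 ⊎ k ≡ 16) size-≡
      (pair-cover-size (SpectralPair-sym pair)
        (large-sets-cover A (subst (λ k → 16 ℕ.< k ℕ.+ k) (sym size-≡) large)))
  size-arithmetic : {k : ℕ} → k ℕ.< 17 → 0 ℕ.< k → (3 ℕ.≤ k → 4 ∣ k) → (16 ℕ.< k ℕ.+ k → k ≡ 0 ⊎ k ≡ 16) → k ∣ 16
  size-arithmetic = from-yes (ℕₚ.allUpTo? (λ k → (0 ℕ.<? k) →-dec (((3 ℕ.≤? k) →-dec (4 ∣? k)) →-dec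
                                               (((16 ℕ.<? k ℕ.+ k) →-dec ((k ℕ.≟ 0) ⊎-dec (k ℕ.≟ 16))) →-dec (k ∣? 16)))) 17)

obstruction⇒¬spectral : {E : Subset 4} → Nonempty E → Obstruction E → ¬ Spectral E
obstruction⇒¬spectral nonempty (size∤ ∤) spectral =
  ∤ (spectral-size-∣ nonempty spectral)
obstruction⇒¬spectral nonempty (differences-cover ≢16 cover) spectral =
  ≢16 (spectral-cover-size nonempty spectral cover)

-- allPts 4 lists ε first.
nonzero : List (Pt 4)
nonzero = List.drop 1 (allPts 4)

generators : List (List (Pt 4))
generators = List.concatMap (λ n → sublists n nonzero) (List.upTo 5)

tiles-by-spanᵇ : List (Pt 4) → List (Pt 4) → Bool
tiles-by-spanᵇ L gs = tilesᵇ (member (ε ∷ L)) (span gs)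

small-set-tilesᵇ : List (Pt 4) → Bool
small-set-tilesᵇ L = any (tiles-by-spanᵇ L) generators

small-sets : List (List (Pt 4))
small-sets = sublists 0 nonzero ++ sublists 1 nonzero ++ sublists 3 nonzero

-- Every subset of size 1, 2 or 4 containing ε tiles by the span of at most four nonzero points.
small-check : all small-set-tilesᵇ small-sets ≡ true
small-check = refl

small-sets-tile-by-span : (L : List (Pt 4)) → L ∈ₗ small-sets → ∃ λ gs → Tiles (member (ε ∷ L)) ⟨ gs ⟩
small-sets-tile-by-span L L∈ =
  let gs , tiles-by-gs = any-true (tiles-by-spanᵇ L) generators
                           (all-true small-set-tilesᵇ small-sets small-check L∈)
  in gs , tilesᵇ-sound (member (ε ∷ L)) (span gs) tiles-by-gs

small-sets-tile : (E : Subset 4) → Nonempty E → size E ∈ₗ (1 ∷ 2 ∷ 4 ∷ []) → ∃ λ gs → Tiles E ⟨ gs ⟩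
small-sets-tile E (x₀ , x₀∈E) |E|∈ =
  let gs , tiles = small-sets-tile-by-span rest (rest∈ |E|∈) in gs , Tiles-translate {E = E} x₀ rest≗E₀ tiles
  where
  E₀ : Subset 4
  E₀ x = E (x ⊕ x₀)
  ε∈E₀ : ε ∈ E₀
  ε∈E₀ = trans (cong E (⊕-identityˡ x₀)) x₀∈E
  rest : List (Pt 4)
  rest = List.filter (λ x → E₀ x ≟ᵇ true) nonzero
  elements-E₀ : elements E₀ ≡ ε ∷ rest
  elements-E₀ = filter-accept (λ x → E₀ x ≟ᵇ true) ε∈E₀
  rest≗E₀ : ∀ x → member (ε ∷ rest) x ≡ E (x ⊕ x₀)
  rest≗E₀ x = trans (cong (λ L → member L x) (sym elements-E₀)) (member-elements E₀ x)
  1+|rest|≡|E| : suc (List.length rest) ≡ size E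
  1+|rest|≡|E| = trans (cong List.length (sym elements-E₀)) (trans (length-elements E₀) (size-shift E x₀))
  rest∈sublists : {n : ℕ} → size E ≡ suc n → rest ∈ₗ sublists n nonzero
  rest∈sublists |E|≡1+n = subst (λ n → rest ∈ₗ sublists n nonzero)
                                (ℕₚ.suc-injective (trans 1+|rest|≡|E| |E|≡1+n))
                                (filter∈sublists (λ x → E₀ x ≟ᵇ true) nonzero)
  rest∈ : size E ∈ₗ (1 ∷ 2 ∷ 4 ∷ []) → rest ∈ₗ small-sets
  rest∈ (here |E|≡1) =
    ∈-++⁺ˡ {ys = sublists 1 nonzero ++ sublists 3 nonzero} (rest∈sublists |E|≡1)
  rest∈ (there (here |E|≡2)) =
    ∈-++⁺ʳ (sublists 0 nonzero) (∈-++⁺ˡ {ys = sublists 3 nonzero} (rest∈sublists |E|≡2))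
  rest∈ (there (there (here |E|≡4))) =
    ∈-++⁺ʳ (sublists 0 nonzero) (∈-++⁺ʳ (sublists 1 nonzero) (rest∈sublists |E|≡4))

subgroup-tiling-or-obstruction : (E : Subset 4) → Nonempty E → TilesBySubgroup E ⊎ Obstruction E
subgroup-tiling-or-obstruction E nonempty with size E ∣? 16
... | no  ∤    = inj₂ (size∤ ∤)
... | yes ∣16 = by-size (divisor-of-16 ∣16)
  where
  spanned : (∃ λ gs → Tiles E ⟨ gs ⟩) → TilesBySubgroup E ⊎ Obstruction E
  spanned (gs , tiles) = inj₁ (⟨ gs ⟩ , span-isSubgroup gs , tiles)
  by-size : size E ∈ₗ powers-of-two → TilesBySubgroup E ⊎ Obstruction E
  by-size (here |E|≡1)                 = spanned (small-sets-tile E nonempty (here |E|≡1))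
  by-size (there (here |E|≡2))         = spanned (small-sets-tile E nonempty (there (here |E|≡2)))
  by-size (there (there (here |E|≡4))) = spanned (small-sets-tile E nonempty (there (there (here |E|≡4))))
  by-size (there (there (there (here |E|≡8)))) with differences-cover? E
  ... | inj₁ cover      =
    inj₂ (differences-cover (λ |E|≡16 → contradiction (trans (sym |E|≡8) |E|≡16) λ ()) cover)
  ... | inj₂ (t , gap) = spanned (t ∷ [] , gap-tiles E t (cong₂ ℕ._+_ |E|≡8 |E|≡8) gap)
  by-size (there (there (there (there (here |E|≡16))))) = spanned ([] , full-tiles E (size-full E |E|≡16))

mainTheorem1 : (E : Subset 4) → Nonempty E →
    (Tiling E → Spectral E) × (Spectral E → Tiling E)
mainTheorem1 E nonempty with subgroup-tiling-or-obstruction E nonempty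
... | inj₁ (H , subgroup , tiles) = (λ _ → subgroup-tiling⇒spectral subgroup tiles) , (λ _ → H , tiles)
... | inj₂ obstruction = (λ tiling → contradiction tiling (obstruction⇒¬tiling obstruction))
                       , (λ spectral → contradiction spectral (obstruction⇒¬spectral nonempty obstruction))
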